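{- Let $n=d+m(d-2)$ with $d\ge 3$ and $m\in\mathbb{N}_0$. Let $\mathcal{T}$ be a $d$-angulation of the convex $n$-gon $\mathcal{P}_n$ and let $M_\mathcal{T}=(m_{i,j})$ be its associated matrix of numbers of $d$-paths. Then $m_{i,j}=m_{j,i}$ for all $1\le i,j\le n$, i.e. $M_\mathcal{T}$ is symmetric.
   Context: $\mathcal{P}_n$ is a convex $n$-gon whose vertices are labelled $1,\dots,n$ in counterclockwise order; vertex labels are taken modulo $n$. A $d$-angulation of $\mathcal{P}_n$ is a dissection of $\mathcal{P}_n$ by pairwise non-crossing diagonals into $d$-gons. For vertices $i,j$, a (counterclockwise) $d$-path from $i$ to $j$ is a sequence $p_{i+1},p_{i+2},\dots,p_{j-1}$ of $d$-gons of $\mathcal{T}$, indexed by the vertices met strictly between $i$ and $j$ when going counterclockwise from $i$ to $j$ (the empty sequence if $j=i+1$; the $n-1$ vertices other than $i$ if $j=i$), such that (i) $p_k$ is incident to vertex $k$ for every such $k$, and (ii) every $d$-gon of $\mathcal{T}$ appears at most $d-2$ times in the sequence. $m_{i,j}$ is the number of $d$-paths from $i$ to $j$ and $M_\mathcal{T}=(m_{i,j})_{1\le i,j\le n}$. -}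

module Defs where

open import Data.Nat using (ℕ; zero; suc; _+_; _*_; _∸_; _≤_; _≤ᵇ_; _≡ᵇ_)
open import Data.Fin using (Fin; toℕ)
open import Data.Fin.Properties using (_≟_)
open import Data.Bool using (Bool; true; false; if_then_else_; _∧_)
open import Data.List using (List; []; _∷_; _++_; map; concatMap; filter; length; allFin; lookup)
open import Data.Bool.ListAction using (any; all)
open import Relation.Nullary.Decidable using (⌊_⌋)
open import Relation.Unary using (Decidable)
open import Relation.Binary.PropositionalEquality using (_≡_)
open import Data.Bool using (T)

-- Vertices of P_n are 0,1,…,n-1 (label k+1 of the paper ↔ 0-based k),
-- in counterclockwise order.
--
-- Dang d a b : a d-angulation of the convex sub-polygon with vertices
-- a, a+1, …, b (a < b), whose side {a,b} is a side of the polygon.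
--   * side a     : the degenerate "polygon" {a, a+1} (just an edge, no cells)
--   * poly ch    : the d-gon containing the side {a,b} has vertices
--                  a = c0 < c1 < … < c(d-1) = b; the chain ch gives, for each
--                  consecutive pair (c_t, c(t+1)), a d-angulation of the
--                  sub-polygon c_t, …, c(t+1) cut off by that side.
-- Every d-angulation of the polygon with vertices 0..b arises exactly once.

mutual
  data Dang (d : ℕ) : ℕ → ℕ → Set where
    side : (a : ℕ) → Dang d a (suc a)
    poly : ∀ {a b} → Chain d (d ∸ 1) a b → Dang d a b

  data Chain (d : ℕ) : ℕ → ℕ → ℕ → Set where
    []  : ∀ {a} → Chain d 0 a a
    _∷_ : ∀ {k a b c} → Dang d a b → Chain d k b c → Chain d (suc k) a c

DAngulation : ℕ → ℕ → Set
DAngulation d n = Dang d 0 (n ∸ 1)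

mutual
  cellsD : ∀ {d a b} → Dang d a b → List (List ℕ)
  cellsD (side a) = []
  cellsD (poly {a} ch) = (a ∷ verts ch) ∷ cellsC ch

  verts : ∀ {d k a b} → Chain d k a b → List ℕ
  verts [] = []
  verts (_∷_ {b = b} x ch) = b ∷ verts ch

  cellsC : ∀ {d k a b} → Chain d k a b → List (List ℕ)
  cellsC [] = []
  cellsC (x ∷ ch) = cellsD x ++ cellsC ch

next : ℕ → ℕ → ℕ
next n k = if suc k ≡ᵇ n then 0 else suc k

walk : ℕ → ℕ → ℕ → ℕ → List ℕ
walk n zero k j = []
walk n (suc f) k j = if next n k ≡ᵇ j then [] else next n k ∷ walk n f (next n k) j

between : ℕ → ℕ → ℕ → List ℕ
between n i j = walk n n i j

module _ (d : ℕ) (cs : List (List ℕ)) where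
  Cell : Set
  Cell = Fin (length cs)

  incident : ℕ → Cell → Bool
  incident k c = any (λ v → v ≡ᵇ k) (lookup cs c)

  candidates : List ℕ → List (List Cell)
  candidates [] = [] ∷ []
  candidates (k ∷ vs) =
    concatMap (λ c → map (c ∷_) (candidates vs))
              (filter (λ c → T? (incident k c)) (allFin (length cs)))
    where
      T? : (b : Bool) → Relation.Nullary.Decidable.Dec (T b)
      T? true = Relation.Nullary.Decidable.yes _
      T? false = Relation.Nullary.Decidable.no (λ ())

  occurrences : Cell → List Cell → ℕ
  occurrences c ps = length (filter (λ p → p ≟ c) ps)

  admissible : List Cell → Bool
  admissible ps = all (λ c → occurrences c ps ≤ᵇ (d ∸ 2)) (allFin (length cs))

  countPaths : List ℕ → ℕ
  countPaths vs = length (filter (λ ps → T?' (admissible ps)) (candidates vs))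
    where
      T?' : (b : Bool) → Relation.Nullary.Decidable.Dec (T b)
      T?' true = Relation.Nullary.Decidable.yes _
      T?' false = Relation.Nullary.Decidable.no (λ ())

pathMatrix : ∀ {d} n → DAngulation d n → Fin n → Fin n → ℕ
pathMatrix {d} n T i j = countPaths d (cellsD T) (between n (toℕ i) (toℕ j))

{-# OPTIONS --safe #-}
-- A d-path from i to j assigns to each vertex strictly between i and j an incident d-gon,
-- no d-gon used more than d - 2 times; the number of such assignments does not depend on
-- the order in which the vertices are served. Build T by gluing its d-gons one at a time
-- onto a side of the polygon built so far, starting from the side {0, n - 1}, and keep the
-- invariant that on the current polygon the path counts are symmetric and vanish on the
-- diagonal. Gluing a d-gon E onto the side {a, b} preserves it: an old arc passing over the
-- new vertices spends all d - 2 uses of E on them; the count from a new vertex to an old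
-- vertex j is m(b, j) + m(a, j), and that from j back is m(j, a) + m(j, b); between two new
-- vertices there is exactly one path in each direction, and none all the way round.
module Submission where

open import Algebra.Bundles using (CommutativeMonoid)
open import Data.Bool using (Bool; true; false; if_then_else_; _∧_; _∨_; not; T; T?)
open import Data.Bool.ListAction using (any; all)
open import Data.Bool.Properties using (∧-commutativeMonoid; ∧-zeroʳ; ∨-zeroʳ; ∨-identityʳ; ∧-identityʳ; ∨-comm; ∨-assoc)
open import Data.Empty using (⊥; ⊥-elim)
open import Data.Fin using (Fin; toℕ; zero; suc)
import Data.Fin.Properties as FinP
open import Data.Fin.Properties using (toℕ<n)
open import Data.List using (List; []; _∷_; _++_; _∷ʳ_; length; map; filter; concatMap; allFin; lookup; tabulate)
open import Data.List.Properties using (++-identityʳ; ++-assoc; map-++)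
open import Data.List.Membership.Propositional using (_∈_)
open import Data.List.Membership.Propositional.Properties using (∈-allFin)
open import Data.List.Relation.Unary.All using (All; []; _∷_)
import Data.List.Relation.Unary.All as All
import Data.List.Relation.Unary.All.Properties as AllP
open import Data.List.Relation.Unary.Any using (here; there)
open import Data.List.Relation.Binary.Permutation.Propositional as Perm using (_↭_)
open import Data.List.Relation.Binary.Permutation.Propositional.Properties using (shift; ++⁺ˡ)
open import Data.Nat using (ℕ; zero; suc; _+_; _*_; _∸_; _≤_; _<_; z≤n; s≤s; _≡ᵇ_; _<ᵇ_; _≤ᵇ_)
open import Data.Nat.Properties
open import Algebra.Properties.CommutativeSemigroup +-commutativeSemigroup using () renaming (interchange to +-interchange)
open import Algebra.Properties.CommutativeSemigroup (CommutativeMonoid.commutativeSemigroup ∧-commutativeMonoid) using () renaming (interchange to ∧-interchange)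
open import Data.Product using (_×_; _,_; proj₁; proj₂)
open import Data.Sum using (_⊎_; inj₁; inj₂)
open import Data.Unit using (⊤; tt)
open import Relation.Binary.Definitions using (tri<; tri≈; tri>)
open import Relation.Binary.PropositionalEquality using (_≡_; refl; sym; trans; cong; cong₂; subst; _≢_; ≢-sym)
open Relation.Binary.PropositionalEquality.≡-Reasoning
open import Relation.Nullary using (yes; no; does; Dec)
open import Relation.Nullary.Decidable using (dec-true; dec-false)
open import Defs

T⇒≡true : ∀ {b} → T b → b ≡ true
T⇒≡true {true} t = refl

≡true⇒T : ∀ {b} → b ≡ true → T b
≡true⇒T refl = tt

≡ᵇ-refl : ∀ v → (v ≡ᵇ v) ≡ true
≡ᵇ-refl v = T⇒≡true (≡⇒≡ᵇ v v refl)

≡ᵇ-true⇒≡ : ∀ {v w} → (v ≡ᵇ w) ≡ true → v ≡ w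
≡ᵇ-true⇒≡ {v} {w} e = ≡ᵇ⇒≡ v w (≡true⇒T e)

≢⇒≡ᵇ-false : ∀ {v w} → v ≢ w → (v ≡ᵇ w) ≡ false
≢⇒≡ᵇ-false {v} {w} ne with v ≡ᵇ w in e
... | true = ⊥-elim (ne (≡ᵇ-true⇒≡ e))
... | false = refl

<⇒<ᵇ-true : ∀ {m n} → m < n → (m <ᵇ n) ≡ true
<⇒<ᵇ-true l = T⇒≡true (<⇒<ᵇ l)

<ᵇ-true⇒< : ∀ {m n} → (m <ᵇ n) ≡ true → m < n
<ᵇ-true⇒< {m} {n} e = <ᵇ⇒< m n (≡true⇒T e)

≥⇒<ᵇ-false : ∀ {m n} → n ≤ m → (m <ᵇ n) ≡ false
≥⇒<ᵇ-false {m} {n} le with m <ᵇ n in e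
... | true = ⊥-elim (<⇒≱ (<ᵇ-true⇒< e) le)
... | false = refl

<⊎≥ : ∀ m n → (m < n) ⊎ (n ≤ m)
<⊎≥ m n with <-cmp m n
... | tri< l _ _ = inj₁ l
... | tri≈ _ refl _ = inj₂ ≤-refl
... | tri> _ _ g = inj₂ (<⇒≤ g)

≡⊎≢ : ∀ m n → (m ≡ n) ⊎ (m ≢ n)
≡⊎≢ m n with <-cmp m n
... | tri< _ ne _ = inj₂ ne
... | tri≈ _ e _ = inj₁ e
... | tri> _ ne _ = inj₂ ne

<ᵇ-irrefl : ∀ {m} → (m <ᵇ m) ≡ false
<ᵇ-irrefl {m} = ≥⇒<ᵇ-false {m} {m} ≤-refl

-- A pool pairs each cell (its vertex list) with the number of times it may still be used.
-- assignments st vs counts the ways to give every vertex of vs an incident cell of st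
-- within these capacities; choose st v k sums k over the pools left after spending one
-- use of a cell incident to v.
Pool : Set
Pool = List (List ℕ × ℕ)

infix 7 _∈ᵇ_
_∈ᵇ_ : ℕ → List ℕ → Bool
v ∈ᵇ c = any (λ w → w ≡ᵇ v) c

useIf : Bool → ℕ → (ℕ → ℕ) → ℕ
useIf true  (suc r) f = f r
useIf true  zero    f = 0
useIf false r       f = 0

choose : Pool → ℕ → (Pool → ℕ) → ℕ
choose []             v k = 0
choose ((c , r) ∷ st) v k =
  useIf (v ∈ᵇ c) r (λ r' → k ((c , r') ∷ st)) + choose st v (λ s → k ((c , r) ∷ s))

assignments : Pool → List ℕ → ℕ
assignments st []       = 1
assignments st (v ∷ vs) = choose st v (λ s → assignments s vs)

useIf-cong : ∀ b r {f g : ℕ → ℕ} → (∀ r' → f r' ≡ g r') → useIf b r f ≡ useIf b r g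
useIf-cong true  (suc r) e = e r
useIf-cong true  zero    e = refl
useIf-cong false r       e = refl

useIf-zero : ∀ b r → useIf b r (λ _ → 0) ≡ 0
useIf-zero true  (suc r) = refl
useIf-zero true  zero    = refl
useIf-zero false r       = refl

useIf-0 : ∀ b (f : ℕ → ℕ) → useIf b 0 f ≡ 0
useIf-0 true  f = refl
useIf-0 false f = refl

useIf-+ : ∀ b r (f g : ℕ → ℕ) → useIf b r (λ r' → f r' + g r') ≡ useIf b r f + useIf b r g
useIf-+ true  (suc r) f g = refl
useIf-+ true  zero    f g = refl
useIf-+ false r       f g = refl

useIf-comm : ∀ b b' r (f : ℕ → ℕ) → useIf b r (λ r' → useIf b' r' f) ≡ useIf b' r (λ r' → useIf b r' f)
useIf-comm true  true  r       f = refl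
useIf-comm false false r       f = refl
useIf-comm true  false zero    f = refl
useIf-comm true  false (suc r) f = refl
useIf-comm false true  zero    f = refl
useIf-comm false true  (suc r) f = refl

useIf-mono : ∀ b {r r'} {f g : ℕ → ℕ} → r ≤ r' → (∀ {s s'} → s ≤ s' → f s ≤ g s') → useIf b r f ≤ useIf b r' g
useIf-mono true  {suc r} {suc r'} (s≤s r≤r') f≤g = f≤g r≤r'
useIf-mono true  {zero}           r≤r'       f≤g = z≤n
useIf-mono false                  r≤r'       f≤g = z≤n

choose-cong : ∀ st v {k k' : Pool → ℕ} → (∀ s → k s ≡ k' s) → choose st v k ≡ choose st v k'
choose-cong []             v e = refl
choose-cong ((c , r) ∷ st) v e = cong₂ _+_ (useIf-cong (v ∈ᵇ c) r (λ _ → e _)) (choose-cong st v (λ _ → e _))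

choose-zero : ∀ st v → choose st v (λ _ → 0) ≡ 0
choose-zero []             v = refl
choose-zero ((c , r) ∷ st) v = cong₂ _+_ (useIf-zero (v ∈ᵇ c) r) (choose-zero st v)

choose-+ : ∀ st v (k k' : Pool → ℕ) → choose st v (λ s → k s + k' s) ≡ choose st v k + choose st v k'
choose-+ []             v k k' = refl
choose-+ ((c , r) ∷ st) v k k' =
  trans (cong₂ _+_ (useIf-+ (v ∈ᵇ c) r _ _) (choose-+ st v _ _)) (+-interchange (useIf (v ∈ᵇ c) r _) _ _ _)

choose-useIf : ∀ st v b r (g : ℕ → Pool → ℕ) →
  choose st v (λ s → useIf b r (λ r' → g r' s)) ≡ useIf b r (λ r' → choose st v (g r'))
choose-useIf st v true  (suc r) g = refl
choose-useIf st v true  zero    g = choose-zero st v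
choose-useIf st v false r       g = choose-zero st v

choose-comm : ∀ st v w (k : Pool → ℕ) → choose st v (λ s → choose s w k) ≡ choose st w (λ s → choose s v k)
choose-comm []             v w k = refl
choose-comm ((c , r) ∷ st) v w k =
  begin
    choose ((c , r) ∷ st) v (λ s → choose s w k)
  ≡⟨ expand v w ⟩
    (both v w + first v w) + (first w v + rest v w)
  ≡⟨ +-interchange (both v w) _ _ _ ⟩
    (both v w + first w v) + (first v w + rest v w)
  ≡⟨ cong₂ (λ x y → (x + first w v) + (first v w + y))
           (useIf-comm (v ∈ᵇ c) (w ∈ᵇ c) r _) (choose-comm st v w _) ⟩
    (both w v + first w v) + (first v w + rest w v)
  ≡⟨ expand w v ⟨
    choose ((c , r) ∷ st) w (λ s → choose s v k)
  ∎
  where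
  both first rest : ℕ → ℕ → ℕ
  both v w  = useIf (v ∈ᵇ c) r (λ r' → useIf (w ∈ᵇ c) r' (λ r'' → k ((c , r'') ∷ st)))
  first v w = useIf (v ∈ᵇ c) r (λ r' → choose st w (λ s → k ((c , r') ∷ s)))
  rest v w  = choose st v (λ s → choose s w (λ s' → k ((c , r) ∷ s')))
  expand : ∀ v w → choose ((c , r) ∷ st) v (λ s → choose s w k) ≡ (both v w + first v w) + (first w v + rest v w)
  expand v w = cong₂ _+_ (useIf-+ (v ∈ᵇ c) r _ _)
                         (trans (choose-+ st v _ _) (cong (_+ rest v w) (choose-useIf st v (w ∈ᵇ c) r _)))

assignments-↭ : ∀ {xs ys} → xs ↭ ys → ∀ st → assignments st xs ≡ assignments st ys
assignments-↭ Perm.refl          st = refl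
assignments-↭ (Perm.prep x p)    st = choose-cong st x (assignments-↭ p)
assignments-↭ {ys = _ ∷ _ ∷ ys} (Perm.swap x y p) st =
  trans (choose-cong st x (λ s → choose-cong s y (assignments-↭ p)))
        (choose-comm st x y (λ s → assignments s ys))
assignments-↭ (Perm.trans p q)   st = trans (assignments-↭ p st) (assignments-↭ q st)

choose-++ : ∀ st st' v (k : Pool → ℕ) →
  choose (st ++ st') v k ≡ choose st v (λ s → k (s ++ st')) + choose st' v (λ s → k (st ++ s))
choose-++ []             st' v k = refl
choose-++ ((c , r) ∷ st) st' v k =
  trans (cong (useIf (v ∈ᵇ c) r (λ r' → k ((c , r') ∷ st ++ st')) +_) (choose-++ st st' v _)) (sym (+-assoc (useIf (v ∈ᵇ c) r _) _ _))

choose-∷ʳ : ∀ st E r v (k : Pool → ℕ) →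
  choose (st ∷ʳ (E , r)) v k ≡ choose st v (λ s → k (s ∷ʳ (E , r))) + useIf (v ∈ᵇ E) r (λ r' → k (st ∷ʳ (E , r')))
choose-∷ʳ st E r v k = trans (choose-++ st _ v k) (cong (choose st v (λ s → k (s ∷ʳ (E , r))) +_) (+-identityʳ _))

assignments-∷ʳ-unused : ∀ E r vs → All (λ v → v ∈ᵇ E ≡ false) vs →
  ∀ st → assignments (st ∷ʳ (E , r)) vs ≡ assignments st vs
assignments-∷ʳ-unused E r []       []            st = refl
assignments-∷ʳ-unused E r (v ∷ vs) (v∉E ∷ vs∉E) st =
  trans (choose-∷ʳ st E r v _)
    (trans (cong₂ _+_ (choose-cong st v (assignments-∷ʳ-unused E r vs vs∉E)) (cong (λ b → useIf b r _) v∉E))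
           (+-identityʳ _))

assignments-∷ʳ-0 : ∀ E vs st → assignments (st ∷ʳ (E , 0)) vs ≡ assignments st vs
assignments-∷ʳ-0 E []       st = refl
assignments-∷ʳ-0 E (v ∷ vs) st =
  trans (choose-∷ʳ st E 0 v _)
    (trans (cong₂ _+_ (choose-cong st v (assignments-∷ʳ-0 E vs)) (useIf-0 (v ∈ᵇ E) _))
           (+-identityʳ _))

assignments-∷ʳ-head : ∀ E st v vs r → v ∈ᵇ E ≡ true → All (λ w → w ∈ᵇ E ≡ false) vs →
  assignments (st ∷ʳ (E , r)) (v ∷ vs) ≡ assignments st (v ∷ vs) + useIf true r (λ _ → assignments st vs)
assignments-∷ʳ-head E st v vs r v∈E vs∉E =
  trans (choose-∷ʳ st E r v _)
    (cong₂ _+_ (choose-cong st v (assignments-∷ʳ-unused E r vs vs∉E))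
               (trans (cong (λ b → useIf b r _) v∈E)
                      (useIf-cong true r (λ r' → assignments-∷ʳ-unused E r' vs vs∉E st))))

Avoids : ℕ → Pool → Set
Avoids v st = All (λ cr → v ∈ᵇ proj₁ cr ≡ false) st

choose-avoided : ∀ st v k → Avoids v st → choose st v k ≡ 0
choose-avoided []             v k []          = refl
choose-avoided ((c , r) ∷ st) v k (v∉c ∷ v∉st) rewrite v∉c = choose-avoided st v _ v∉st

assignments-∷ʳ-private : ∀ E st es vs r → All (λ v → v ∈ᵇ E ≡ true × Avoids v st) es → length es ≤ r →
  assignments (st ∷ʳ (E , r)) (es ++ vs) ≡ assignments (st ∷ʳ (E , r ∸ length es)) vs
assignments-∷ʳ-private E st []       vs r       []                  le        = refl
assignments-∷ʳ-private E st (e ∷ es) vs (suc r) ((e∈E , e∉st) ∷ hs) (s≤s le) =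
  trans (choose-∷ʳ st E (suc r) e _)
    (trans (cong₂ _+_ (choose-avoided st e _ e∉st) (cong (λ b → useIf b (suc r) _) e∈E))
           (assignments-∷ʳ-private E st es vs r hs le))

_⊑_ : Pool → Pool → Set
[]             ⊑ []               = ⊤
[]             ⊑ (_ ∷ _)          = ⊥
(_ ∷ _)        ⊑ []               = ⊥
((c , r) ∷ st) ⊑ ((c' , r') ∷ st') = (c ≡ c') × (r ≤ r') × (st ⊑ st')

⊑-refl : ∀ st → st ⊑ st
⊑-refl []             = tt
⊑-refl ((c , r) ∷ st) = refl , ≤-refl , ⊑-refl st

choose-mono : ∀ st st' v (k k' : Pool → ℕ) → st ⊑ st' → (∀ {s s'} → s ⊑ s' → k s ≤ k' s') →
  choose st v k ≤ choose st' v k'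
choose-mono []             []               v k k' le          k≤k' = z≤n
choose-mono ((c , r) ∷ st) ((.c , r') ∷ st') v k k' (refl , r≤r' , le) k≤k' =
  +-mono-≤ (useIf-mono (v ∈ᵇ c) r≤r' (λ l → k≤k' (refl , l , le)))
           (choose-mono st st' v _ _ le (λ l → k≤k' (refl , r≤r' , l)))

assignments-mono : ∀ vs st st' → st ⊑ st' → assignments st vs ≤ assignments st' vs
assignments-mono []       st st' le = ≤-refl
assignments-mono (v ∷ vs) st st' le = choose-mono st st' v _ _ le (assignments-mono vs _ _)

useIf-vanish : ∀ b r (f : ℕ → ℕ) → (∀ r' → r' < r → f r' ≡ 0) → useIf b r f ≡ 0
useIf-vanish true  (suc r) f h = h r ≤-refl
useIf-vanish true  zero    f h = refl
useIf-vanish false r       f h = refl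

choose-vanish : ∀ st v (k : Pool → ℕ) → (∀ s → s ⊑ st → k s ≡ 0) → choose st v k ≡ 0
choose-vanish []             v k h = refl
choose-vanish ((c , r) ∷ st) v k h =
  cong₂ _+_ (useIf-vanish (v ∈ᵇ c) r _ (λ r' r'<r → h _ (refl , <⇒≤ r'<r , ⊑-refl st)))
            (choose-vanish st v _ (λ s l → h _ (refl , ≤-refl , l)))

assignments-∷-0 : ∀ st v vs → assignments st vs ≡ 0 → assignments st (v ∷ vs) ≡ 0
assignments-∷-0 st v vs e =
  choose-vanish st v _ (λ s l → n≤0⇒n≡0 (subst (assignments s vs ≤_) e (assignments-mono vs s st l)))

withCapacity : ℕ → List (List ℕ) → Pool
withCapacity r = map (λ c → c , r)

assignments-∷ʳ-pair : ∀ E st a b R r → a ∈ᵇ E ≡ true → b ∈ᵇ E ≡ true → All (λ w → w ∈ᵇ E ≡ false) R →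
  assignments st R ≡ 1 → assignments st (a ∷ R) ≡ 0 → assignments st (b ∷ R) ≡ 0 →
  assignments (st ∷ʳ (E , r)) (b ∷ a ∷ R) ≡ (if 2 ≤ᵇ r then 1 else 0)
assignments-∷ʳ-pair E st a b R r a∈E b∈E R∉E R1 aR0 bR0 =
  begin
    assignments (st ∷ʳ (E , r)) (b ∷ a ∷ R)
  ≡⟨ choose-∷ʳ st E r b _ ⟩
    choose st b (λ s → assignments (s ∷ʳ (E , r)) (a ∷ R)) + useIf (b ∈ᵇ E) r (λ r' → assignments (st ∷ʳ (E , r')) (a ∷ R))
  ≡⟨ cong₂ _+_ (choose-cong st b (λ s → assignments-∷ʳ-head E s a R r a∈E R∉E)) (cong (λ x → useIf x r _) b∈E) ⟩
    choose st b (λ s → assignments s (a ∷ R) + useIf true r (λ _ → assignments s R))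
      + useIf true r (λ r' → assignments (st ∷ʳ (E , r')) (a ∷ R))
  ≡⟨ cong₂ _+_ (trans (choose-+ st b _ _) (cong₂ _+_ (assignments-∷-0 st b (a ∷ R) aR0) (choose-useIf st b true r _)))
               (useIf-cong true r (λ r' → assignments-∷ʳ-head E st a R r' a∈E R∉E)) ⟩
    (0 + useIf true r (λ _ → assignments st (b ∷ R)))
      + useIf true r (λ r' → assignments st (a ∷ R) + useIf true r' (λ _ → assignments st R))
  ≡⟨ cong₂ _+_ (cong (0 +_) (useIf-cong true r (λ _ → bR0)))
               (useIf-cong true r (λ r' → cong₂ _+_ aR0 (useIf-cong true r' (λ _ → R1)))) ⟩
    (0 + useIf true r (λ _ → 0)) + useIf true r (λ r' → 0 + useIf true r' (λ _ → 1))
  ≡⟨ atLeastTwo r ⟩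
    (if 2 ≤ᵇ r then 1 else 0)
  ∎
  where
  atLeastTwo : ∀ r → (0 + useIf true r (λ _ → 0)) + useIf true r (λ r' → 0 + useIf true r' (λ _ → 1)) ≡ (if 2 ≤ᵇ r then 1 else 0)
  atLeastTwo zero          = refl
  atLeastTwo (suc zero)    = refl
  atLeastTwo (suc (suc r)) = refl

sumL : {A : Set} → (A → ℕ) → List A → ℕ
sumL f []       = 0
sumL f (x ∷ xs) = f x + sumL f xs

sumFin : ∀ K → (Fin K → ℕ) → ℕ
sumFin zero    f = 0
sumFin (suc K) f = f zero + sumFin K (λ c → f (suc c))

sumFin-cong : ∀ K {f g : Fin K → ℕ} → (∀ c → f c ≡ g c) → sumFin K f ≡ sumFin K g
sumFin-cong zero    h = refl
sumFin-cong (suc K) h = cong₂ _+_ (h zero) (sumFin-cong K (λ c → h (suc c)))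

sumL-tabulate : ∀ K {A : Set} (f : A → ℕ) (g : Fin K → A) → sumL f (tabulate g) ≡ sumFin K (λ c → f (g c))
sumL-tabulate zero    f g = refl
sumL-tabulate (suc K) f g = cong (f (g zero) +_) (sumL-tabulate K f (λ c → g (suc c)))

countᵇ : {A : Set} → (A → Bool) → List A → ℕ
countᵇ p []       = 0
countᵇ p (x ∷ xs) = (if p x then 1 else 0) + countᵇ p xs

length-filter : ∀ {A : Set} (p : A → Bool) (p? : ∀ x → Dec (T (p x))) xs → length (filter p? xs) ≡ countᵇ p xs
length-filter p p? [] = refl
length-filter p p? (x ∷ xs) with p? x
... | yes px rewrite T⇒≡true px = cong suc (length-filter p p? xs)
... | no ¬px with p x
...   | true  = ⊥-elim (¬px _)
...   | false = length-filter p p? xs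

sumL-filter : ∀ {A : Set} (p : A → Bool) (p? : ∀ x → Dec (T (p x))) (f : A → ℕ) xs →
  sumL f (filter p? xs) ≡ sumL (λ x → if p x then f x else 0) xs
sumL-filter p p? f [] = refl
sumL-filter p p? f (x ∷ xs) with p? x
... | yes px rewrite T⇒≡true px = cong (f x +_) (sumL-filter p p? f xs)
... | no ¬px with p x
...   | true  = ⊥-elim (¬px _)
...   | false = sumL-filter p p? f xs

filter-irrelevant : ∀ {A : Set} {R : A → Set} (P Q : ∀ x → Dec (R x)) xs → filter P xs ≡ filter Q xs
filter-irrelevant P Q [] = refl
filter-irrelevant P Q (x ∷ xs) with P x | Q x
... | yes p | yes q = cong (x ∷_) (filter-irrelevant P Q xs)
... | no ¬p | no ¬q = filter-irrelevant P Q xs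
... | yes p | no ¬q = ⊥-elim (¬q p)
... | no ¬p | yes q = ⊥-elim (¬p q)

countᵇ-++ : ∀ {A : Set} (p : A → Bool) xs ys → countᵇ p (xs ++ ys) ≡ countᵇ p xs + countᵇ p ys
countᵇ-++ p []       ys = refl
countᵇ-++ p (x ∷ xs) ys = trans (cong (_ +_) (countᵇ-++ p xs ys)) (sym (+-assoc (if p x then 1 else 0) _ _))

countᵇ-concatMap : ∀ {A B : Set} (p : B → Bool) (f : A → List B) xs →
  countᵇ p (concatMap f xs) ≡ sumL (λ x → countᵇ p (f x)) xs
countᵇ-concatMap p f []       = refl
countᵇ-concatMap p f (x ∷ xs) = trans (countᵇ-++ p (f x) (concatMap f xs)) (cong (countᵇ p (f x) +_) (countᵇ-concatMap p f xs))

countᵇ-map : ∀ {A B : Set} (p : B → Bool) (f : A → B) xs → countᵇ p (map f xs) ≡ countᵇ (λ x → p (f x)) xs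
countᵇ-map p f []       = refl
countᵇ-map p f (x ∷ xs) = cong (_ +_) (countᵇ-map p f xs)

countᵇ-cong : ∀ {A : Set} {p q : A → Bool} xs → (∀ x → p x ≡ q x) → countᵇ p xs ≡ countᵇ q xs
countᵇ-cong []       h = refl
countᵇ-cong (x ∷ xs) h = cong₂ _+_ (cong (λ b → if b then 1 else 0) (h x)) (countᵇ-cong xs h)

countᵇ-false : ∀ {A : Set} (xs : List A) → countᵇ (λ _ → false) xs ≡ 0
countᵇ-false []       = refl
countᵇ-false (x ∷ xs) = countᵇ-false xs

all-cong : ∀ {A : Set} {f g : A → Bool} xs → (∀ x → f x ≡ g x) → all f xs ≡ all g xs
all-cong []       h = refl
all-cong (x ∷ xs) h = cong₂ _∧_ (h x) (all-cong xs h)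

all-true : ∀ {A : Set} (f : A → Bool) xs → (∀ x → f x ≡ true) → all f xs ≡ true
all-true f []       h = refl
all-true f (x ∷ xs) h rewrite h x = all-true f xs h

all-false : ∀ {A : Set} (f : A → Bool) xs x → x ∈ xs → f x ≡ false → all f xs ≡ false
all-false f (y ∷ xs) x (here refl) e rewrite e = refl
all-false f (y ∷ xs) x (there m)   e rewrite all-false f xs x m e = ∧-zeroʳ _

all-∧ : ∀ {A : Set} (f g : A → Bool) xs → all (λ x → f x ∧ g x) xs ≡ (all f xs ∧ all g xs)
all-∧ f g []       = refl
all-∧ f g (x ∷ xs) rewrite all-∧ f g xs = ∧-interchange (f x) (g x) (all f xs) (all g xs)

suc≤ᵇ : ∀ m x → (suc m ≤ᵇ x) ≡ ((1 ≤ᵇ x) ∧ (m ≤ᵇ x ∸ 1))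
suc≤ᵇ m       zero          = refl
suc≤ᵇ zero    (suc x)       = refl
suc≤ᵇ (suc m) (suc x)       = refl

poolOf : ∀ K → (Fin K → List ℕ) → (Fin K → ℕ) → Pool
poolOf K cells cap = tabulate (λ c → cells c , cap c)

poolOf-const : ∀ r (cs : List (List ℕ)) → poolOf (length cs) (lookup cs) (λ _ → r) ≡ withCapacity r cs
poolOf-const r []       = refl
poolOf-const r (c ∷ cs) = cong ((c , r) ∷_) (poolOf-const r cs)

spendAt : ∀ {K} → (Fin K → ℕ) → Fin K → Fin K → ℕ
spendAt cap c c' = if does (c' FinP.≟ c) then cap c ∸ 1 else cap c'

useCell : ∀ {K} → ℕ → (Fin K → List ℕ) → (Fin K → ℕ) → ((Fin K → ℕ) → ℕ) → Fin K → ℕ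
useCell v cells cap k c = if v ∈ᵇ cells c then (if 1 ≤ᵇ cap c then k (spendAt cap c) else 0) else 0

useCell-cong : ∀ {K} v (cells : Fin K → List ℕ) cap {k k' : (Fin K → ℕ) → ℕ} →
  (∀ cap' → k cap' ≡ k' cap') → ∀ c → useCell v cells cap k c ≡ useCell v cells cap k' c
useCell-cong v cells cap h c with v ∈ᵇ cells c
... | false = refl
... | true with 1 ≤ᵇ cap c
...   | false = refl
...   | true  = h _

choose-poolOf : ∀ K cells cap v (k : Pool → ℕ) →
  choose (poolOf K cells cap) v k ≡ sumFin K (useCell v cells cap (λ cap' → k (poolOf K cells cap')))
choose-poolOf zero    cells cap v k = refl
choose-poolOf (suc K) cells cap v k =
  cong₂ _+_ (head (v ∈ᵇ cells zero) (cap zero))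
            (choose-poolOf K (λ c → cells (suc c)) (λ c → cap (suc c)) v _)
  where
  rest = poolOf K (λ c → cells (suc c)) (λ c → cap (suc c))
  head : ∀ b r → useIf b r (λ r' → k ((cells zero , r') ∷ rest))
               ≡ (if b then (if 1 ≤ᵇ r then k ((cells zero , r ∸ 1) ∷ rest) else 0) else 0)
  head false r       = refl
  head true  zero    = refl
  head true  (suc r) = refl

assignmentsFin : ∀ K → (Fin K → List ℕ) → (Fin K → ℕ) → List ℕ → ℕ
assignmentsFin K cells cap []       = 1
assignmentsFin K cells cap (v ∷ vs) = sumFin K (useCell v cells cap (λ cap' → assignmentsFin K cells cap' vs))

assignments-poolOf : ∀ K cells vs cap → assignments (poolOf K cells cap) vs ≡ assignmentsFin K cells cap vs
assignments-poolOf K cells []       cap = refl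
assignments-poolOf K cells (v ∷ vs) cap =
  trans (choose-poolOf K cells cap v _)
        (sumFin-cong K (useCell-cong v cells cap (assignments-poolOf K cells vs)))

module Bridge (d : ℕ) (cs : List (List ℕ)) where
  K : ℕ
  K = length cs

  occ : Fin K → List (Fin K) → ℕ
  occ = occurrences d cs

  admissibleFor : (Fin K → ℕ) → List (Fin K) → Bool
  admissibleFor cap ps = all (λ c → occ c ps ≤ᵇ cap c) (allFin K)

  admissibleFor-∷ : ∀ cap c ps → admissibleFor cap (c ∷ ps) ≡ ((1 ≤ᵇ cap c) ∧ admissibleFor (spendAt cap c) ps)
  admissibleFor-∷ cap c ps =
    trans (all-cong (allFin K) pointwise)
      (trans (all-∧ (λ c' → if does (c' FinP.≟ c) then (1 ≤ᵇ cap c) else true) _ (allFin K))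
             (cong (_∧ admissibleFor (spendAt cap c) ps) (only-c (1 ≤ᵇ cap c))))
    where
    pointwise : ∀ c' → (occ c' (c ∷ ps) ≤ᵇ cap c')
                     ≡ ((if does (c' FinP.≟ c) then (1 ≤ᵇ cap c) else true) ∧ (occ c' ps ≤ᵇ spendAt cap c c'))
    pointwise c' with c' FinP.≟ c
    ... | yes refl rewrite dec-true (c FinP.≟ c) refl = suc≤ᵇ (occ c ps) (cap c)
    ... | no c'≢c  rewrite dec-false (c FinP.≟ c') (≢-sym c'≢c) = refl
    only-c : ∀ β → all (λ c' → if does (c' FinP.≟ c) then β else true) (allFin K) ≡ β
    only-c true  = all-true _ (allFin K) (λ c' → if-same (does (c' FinP.≟ c)))
      where if-same : ∀ b → (if b then true else true) ≡ true
            if-same true  = refl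
            if-same false = refl
    only-c false = all-false _ (allFin K) c (∈-allFin c) (cong (λ b → if b then false else true) (dec-true (c FinP.≟ c) refl))

  count-admissible : ∀ vs cap → countᵇ (admissibleFor cap) (candidates d cs vs) ≡ assignmentsFin K (lookup cs) cap vs
  count-admissible [] cap rewrite all-true (λ c → occ c [] ≤ᵇ cap c) (allFin K) (λ c → refl) = refl
  count-admissible (v ∷ vs) cap =
    begin
      countᵇ (admissibleFor cap) (concatMap extend (filter _ (allFin K)))
    ≡⟨ cong (λ cs′ → countᵇ (admissibleFor cap) (concatMap extend cs′)) (filter-irrelevant _ v∈? (allFin K)) ⟩
      countᵇ (admissibleFor cap) (concatMap extend (filter v∈? (allFin K)))
    ≡⟨ countᵇ-concatMap (admissibleFor cap) extend (filter v∈? (allFin K)) ⟩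
      sumL (λ c → countᵇ (admissibleFor cap) (extend c)) (filter v∈? (allFin K))
    ≡⟨ sumL-filter (λ c → v ∈ᵇ lookup cs c) v∈? _ (allFin K) ⟩
      sumL (λ c → if v ∈ᵇ lookup cs c then countᵇ (admissibleFor cap) (extend c) else 0) (allFin K)
    ≡⟨ sumL-tabulate K _ (λ c → c) ⟩
      sumFin K (λ c → if v ∈ᵇ lookup cs c then countᵇ (admissibleFor cap) (extend c) else 0)
    ≡⟨ sumFin-cong K per-cell ⟩
      assignmentsFin K (lookup cs) cap (v ∷ vs)
    ∎
    where
    extend : Fin K → List (List (Fin K))
    extend c = map (c ∷_) (candidates d cs vs)
    v∈? : ∀ c → Dec (T (v ∈ᵇ lookup cs c))
    v∈? c = T? (v ∈ᵇ lookup cs c)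
    guarded : ∀ c b → countᵇ (λ ps → b ∧ admissibleFor (spendAt cap c) ps) (candidates d cs vs)
                    ≡ (if b then assignmentsFin K (lookup cs) (spendAt cap c) vs else 0)
    guarded c true  = count-admissible vs (spendAt cap c)
    guarded c false = countᵇ-false (candidates d cs vs)
    per-cell : ∀ c → (if v ∈ᵇ lookup cs c then countᵇ (admissibleFor cap) (extend c) else 0)
                   ≡ useCell v (lookup cs) cap (λ cap' → assignmentsFin K (lookup cs) cap' vs) c
    per-cell c with v ∈ᵇ lookup cs c
    ... | false = refl
    ... | true  = trans (countᵇ-map (admissibleFor cap) (c ∷_) (candidates d cs vs))
                    (trans (countᵇ-cong (candidates d cs vs) (admissibleFor-∷ cap c)) (guarded c (1 ≤ᵇ cap c)))

  countPaths≡assignments : ∀ vs → countPaths d cs vs ≡ assignments (withCapacity (d ∸ 2) cs) vs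
  countPaths≡assignments vs =
    begin
      countPaths d cs vs
    ≡⟨ length-filter (admissible d cs) _ (candidates d cs vs) ⟩
      countᵇ (admissibleFor (λ _ → d ∸ 2)) (candidates d cs vs)
    ≡⟨ count-admissible vs (λ _ → d ∸ 2) ⟩
      assignmentsFin K (lookup cs) (λ _ → d ∸ 2) vs
    ≡⟨ assignments-poolOf K (lookup cs) vs (λ _ → d ∸ 2) ⟨
      assignments (poolOf K (lookup cs) (λ _ → d ∸ 2)) vs
    ≡⟨ cong (λ st → assignments st vs) (poolOf-const (d ∸ 2) cs) ⟩
      assignments (withCapacity (d ∸ 2) cs) vs
    ∎

true≢false : true ≡ false → ⊥
true≢false ()

split-covered : ∀ p e c → (e ≡ true → p ≡ false) → (e ≡ true → c ≡ true) → ((p ∨ e) ∧ c) ≡ (e ∨ (p ∧ c))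
split-covered p true c h1 h2 rewrite h1 refl | h2 refl = refl
split-covered p false c h1 h2 rewrite ∨-identityʳ p = refl

disjoint-covered : ∀ p e c → (e ≡ true → p ≡ false) → (e ∧ (p ∧ c)) ≡ false
disjoint-covered p true c h rewrite h refl = refl
disjoint-covered p false c h = refl

split-missed : ∀ p e c → (e ≡ true → c ≡ false) → ((p ∨ e) ∧ c) ≡ (p ∧ c)
split-missed p true c h rewrite h refl = trans (∧-zeroʳ _) (sym (∧-zeroʳ _))
split-missed p false c h rewrite ∨-identityʳ p = refl

split-mixed : ∀ p e c c' → (e ≡ true → p ≡ false) → (p ≡ true → c ≡ c') → ((p ∨ e) ∧ c) ≡ ((e ∧ c) ∨ (p ∧ c'))
split-mixed p true c c' h1 h2 rewrite h1 refl = sym (∨-identityʳ _)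
split-mixed true false c c' h1 h2 = h2 refl
split-mixed false false c c' h1 h2 = refl

disjoint-mixed : ∀ p e c c' → (e ≡ true → p ≡ false) → ((e ∧ c) ∧ (p ∧ c')) ≡ false
disjoint-mixed p true c c' h rewrite h refl = ∧-zeroʳ _
disjoint-mixed p false c c' h = refl

split-private : ∀ p e c → (p ≡ true → e ≡ false) → (p ≡ true → c ≡ false) → ((p ∨ e) ∧ c) ≡ (e ∧ c)
split-private true e c h1 h2 rewrite h1 refl | h2 refl = refl
split-private false e c h1 h2 = refl

split-vertex : ∀ p q q' x → (p ≡ true → q ≡ (x ∨ q')) → (x ≡ true → p ≡ true) → (p ∧ q) ≡ (x ∨ (p ∧ q'))
split-vertex true q q' x h1 h2 = h1 refl
split-vertex false q q' true h1 h2 = ⊥-elim (true≢false (sym (h2 refl)))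
split-vertex false q q' false h1 h2 = refl

disjoint-vertex : ∀ p q' x → (x ≡ true → q' ≡ false) → (x ∧ (p ∧ q')) ≡ false
disjoint-vertex p q' true h rewrite h refl = ∧-zeroʳ _
disjoint-vertex p q' false h = refl

∧-true⇒ : ∀ {x y} → (x ∧ y) ≡ true → (x ≡ true) × (y ≡ true)
∧-true⇒ {true} {true} e = refl , refl

∨-true⇒ : ∀ {x y} → (x ∨ y) ≡ true → (x ≡ true) ⊎ (y ≡ true)
∨-true⇒ {true} e = inj₁ refl
∨-true⇒ {false} e = inj₂ e

≡false⇒not≡true : ∀ {x} → x ≡ false → not x ≡ true
≡false⇒not≡true refl = refl

≢true⇒≡false : ∀ {x} → (x ≡ true → ⊥) → x ≡ false
≢true⇒≡false {true} h = ⊥-elim (h refl)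
≢true⇒≡false {false} h = refl

∈ᵇ⇒∈ : ∀ v xs → v ∈ᵇ xs ≡ true → v ∈ xs
∈ᵇ⇒∈ v (x ∷ xs) e with ≡⊎≢ x v
... | inj₁ refl = here refl
... | inj₂ ne rewrite ≢⇒≡ᵇ-false ne = there (∈ᵇ⇒∈ v xs e)

∈⇒∈ᵇ : ∀ v xs → v ∈ xs → v ∈ᵇ xs ≡ true
∈⇒∈ᵇ v (x ∷ xs) (here refl) rewrite ≡ᵇ-refl v = refl
∈⇒∈ᵇ v (x ∷ xs) (there m) rewrite ∈⇒∈ᵇ v xs m = ∨-zeroʳ _

bool-ext : ∀ {x y : Bool} → (x ≡ true → y ≡ true) → (y ≡ true → x ≡ true) → x ≡ y
bool-ext {true} {true} f g = refl
bool-ext {true} {false} f g = sym (f refl)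
bool-ext {false} {true} f g = g refl
bool-ext {false} {false} f g = refl

-- filterᵇ without the detour through Dec, which makes the proofs below check much faster.
select : {A : Set} → (A → Bool) → List A → List A
select Q [] = []
select Q (x ∷ xs) = if Q x then x ∷ select Q xs else select Q xs

range : ℕ → ℕ → List ℕ
range k zero = []
range k (suc m) = k ∷ range (suc k) m

range-bounds : ∀ k m → All (λ v → k ≤ v × v < k + m) (range k m)
range-bounds k zero = []
range-bounds k (suc m) = (≤-refl , subst (k <_) (sym (+-suc k m)) (s≤s (m≤m+n k m)))
  ∷ All.map (λ {v} lu → <⇒≤ (proj₁ lu) , subst (v <_) (sym (+-suc k m)) (proj₂ lu)) (range-bounds (suc k) m)

select-cong : ∀ {A : Set} {Q Q' : A → Bool} xs → All (λ v → Q v ≡ Q' v) xs → select Q xs ≡ select Q' xs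
select-cong [] [] = refl
select-cong {Q = Q} {Q'} (x ∷ xs) (e ∷ es) rewrite e with Q' x
... | true = cong (x ∷_) (select-cong xs es)
... | false = select-cong xs es

select-true : ∀ {A : Set} (Q : A → Bool) xs → All (λ v → Q v ≡ true) (select Q xs)
select-true Q [] = []
select-true Q (x ∷ xs) with Q x in e
... | true = e ∷ select-true Q xs
... | false = select-true Q xs

select-All : ∀ {A : Set} (Q : A → Bool) (P : A → Set) xs → All P xs → All P (select Q xs)
select-All Q P [] [] = []
select-All Q P (x ∷ xs) (p ∷ ps) with Q x
... | true = p ∷ select-All Q P xs ps
... | false = select-All Q P xs ps

select-∨-↭ : ∀ {A : Set} {Q Q1 Q2 : A → Bool} xs → All (λ v → Q v ≡ (Q1 v ∨ Q2 v)) xs → All (λ v → (Q1 v ∧ Q2 v) ≡ false) xs →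
  select Q xs ↭ select Q1 xs ++ select Q2 xs
select-∨-↭ [] [] [] = Perm.refl
select-∨-↭ {Q = Q} {Q1} {Q2} (x ∷ xs) (e ∷ es) (d ∷ ds) rewrite e with Q1 x | Q2 x
... | true | true = case d of-⊥
  where case_of-⊥ : true ≡ false → _
        case () of-⊥
... | true | false = Perm.prep x (select-∨-↭ xs es ds)
... | false | true = Perm.trans (Perm.prep x (select-∨-↭ xs es ds)) (Perm.↭-sym (shift x (select Q1 xs) (select Q2 xs)))
... | false | false = select-∨-↭ xs es ds

select-select : ∀ {A : Set} (Q1 Q2 : A → Bool) xs → select Q1 (select Q2 xs) ≡ select (λ v → Q2 v ∧ Q1 v) xs
select-select Q1 Q2 [] = refl
select-select Q1 Q2 (x ∷ xs) with Q2 x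
... | false = select-select Q1 Q2 xs
... | true with Q1 x
... | true = cong (x ∷_) (select-select Q1 Q2 xs)
... | false = select-select Q1 Q2 xs

select-false : ∀ {A : Set} (xs : List A) → select (λ _ → false) xs ≡ []
select-false [] = refl
select-false (x ∷ xs) = select-false xs

select-∈ : ∀ {A : Set} (Q : A → Bool) xs x → x ∈ xs → Q x ≡ true → x ∈ select Q xs
select-∈ Q (y ∷ xs) x (here refl) e rewrite e = here refl
select-∈ Q (y ∷ xs) x (there m) e with Q y
... | true = there (select-∈ Q xs x m e)
... | false = select-∈ Q xs x m e

length-select-not : ∀ {A : Set} (Q : A → Bool) xs → length (select Q xs) + length (select (λ v → not (Q v)) xs) ≡ length xs
length-select-not Q [] = refl
length-select-not Q (x ∷ xs) with Q x
... | true = cong suc (length-select-not Q xs)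
... | false = trans (+-suc _ _) (cong suc (length-select-not Q xs))

range-∈ : ∀ k m x → k ≤ x → x < k + m → x ∈ range k m
range-∈ k zero x l u = ⊥-elim (<⇒≱ u (subst (_≤ x) (sym (+-identityʳ k)) l))
range-∈ k (suc m) x l u with <-cmp k x
... | tri≈ _ refl _ = here refl
... | tri< k<x _ _ = there (range-∈ (suc k) m x k<x (subst (x <_) (+-suc k m) u))
... | tri> _ _ g = ⊥-elim (<⇒≱ g l)

∈⇒length≥1 : ∀ {x} {ys : List ℕ} → x ∈ ys → 1 ≤ length ys
∈⇒length≥1 (here _) = s≤s z≤n
∈⇒length≥1 (there _) = s≤s z≤n

∈⇒length≥2 : ∀ {x y} {ys : List ℕ} → x ∈ ys → y ∈ ys → x ≢ y → 2 ≤ length ys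
∈⇒length≥2 (here refl) (here refl) ne = ⊥-elim (ne refl)
∈⇒length≥2 (here refl) (there m) ne = s≤s (∈⇒length≥1 m)
∈⇒length≥2 (there m) (here refl) ne = s≤s (∈⇒length≥1 m)
∈⇒length≥2 (there m) (there m') ne = s≤s (≤-trans (s≤s z≤n) (∈⇒length≥2 m m' ne))

SortedFrom : ℕ → List ℕ → Set
SortedFrom lo [] = ⊤
SortedFrom lo (x ∷ xs) = lo ≤ x × SortedFrom (suc x) xs

SortedFrom-weaken : ∀ {lo lo'} xs → lo' ≤ lo → SortedFrom lo xs → SortedFrom lo' xs
SortedFrom-weaken [] l h = tt
SortedFrom-weaken (x ∷ xs) l (h , hs) = ≤-trans l h , hs

SortedFrom-∉ : ∀ lo xs v → v < lo → SortedFrom lo xs → v ∈ᵇ xs ≡ false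
SortedFrom-∉ lo [] v l h = refl
SortedFrom-∉ lo (x ∷ xs) v l (h , hs) rewrite ≢⇒≡ᵇ-false {x} {v} (λ e → <⇒≱ l (subst (lo ≤_) e h)) =
  SortedFrom-∉ (suc x) xs v (≤-trans l (≤-trans h (n≤1+n x))) hs

select-range-sorted : ∀ k m L → SortedFrom k L → All (λ v → v < k + m) L → select (λ v → v ∈ᵇ L) (range k m) ≡ L
select-range-sorted k zero [] h b = refl
select-range-sorted k zero (x ∷ L) (h , _) (b ∷ _) = ⊥-elim (<⇒≱ b (subst (_≤ x) (sym (+-identityʳ k)) h))
select-range-sorted k (suc m) [] h b = select-false (range (suc k) m)
select-range-sorted k (suc m) (x ∷ L) (h , hs) (b ∷ bs) with <-cmp k x
... | tri≈ _ refl _ rewrite ≡ᵇ-refl k = cong (k ∷_)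
      (trans (select-cong (range (suc k) m) (All.map (λ {v} lu → cong (λ z → z ∨ (v ∈ᵇ L)) (≢⇒≡ᵇ-false {k} {v} (λ e → <⇒≱ (proj₁ lu) (≤-reflexive (sym e))))) (range-bounds (suc k) m)))
             (select-range-sorted (suc k) m L hs (All.map (λ {v} u → subst (v <_) (+-suc k m) u) bs)))
... | tri< k<x _ _ rewrite ≢⇒≡ᵇ-false {x} {k} (λ e → <⇒≱ k<x (≤-reflexive e)) | SortedFrom-∉ (suc x) L k (≤-trans k<x (n≤1+n x)) hs =
      select-range-sorted (suc k) m (x ∷ L) (k<x , hs) (subst (λ z → All (λ v → v < z) (x ∷ L)) (+-suc k m) (b ∷ bs))
... | tri> _ _ g = ⊥-elim (<⇒≱ g h)

select-range-single : ∀ b k m → k ≤ b → b < k + m → select (λ v → v ≡ᵇ b) (range k m) ≡ b ∷ []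
select-range-single b k zero l u = ⊥-elim (<⇒≱ u (subst (_≤ b) (sym (+-identityʳ k)) l))
select-range-single b k (suc m) l u with <-cmp k b
... | tri≈ _ refl _ rewrite ≡ᵇ-refl k = cong (k ∷_) (trans (select-cong {Q' = λ _ → false} (range (suc k) m)
        (All.map (λ {v} lu → ≢⇒≡ᵇ-false {v} {k} (λ e → <⇒≱ (proj₁ lu) (≤-reflexive e))) (range-bounds (suc k) m))) (select-false (range (suc k) m)))
... | tri< k<b _ _ rewrite ≢⇒≡ᵇ-false {k} {b} (λ e → <⇒≢ k<b e) = select-range-single b (suc k) m k<b (subst (b <_) (+-suc k m) u)
... | tri> _ _ g = ⊥-elim (<⇒≱ g l)

module Vertices (n : ℕ) where
  vertsWhere : (ℕ → Bool) → List ℕ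
  vertsWhere Q = select Q (range 0 n)

  range-bounded : All (λ v → v < n) (range 0 n)
  range-bounded = All.map proj₂ (range-bounds 0 n)

  vertsWhere-cong : ∀ {Q Q'} → (∀ v → v < n → Q v ≡ Q' v) → vertsWhere Q ≡ vertsWhere Q'
  vertsWhere-cong h = select-cong (range 0 n) (All.map (h _) range-bounded)

  vertsWhere-∨-↭ : ∀ {Q Q1 Q2} → (∀ v → v < n → Q v ≡ (Q1 v ∨ Q2 v)) → (∀ v → v < n → (Q1 v ∧ Q2 v) ≡ false) →
    vertsWhere Q ↭ vertsWhere Q1 ++ vertsWhere Q2
  vertsWhere-∨-↭ h1 h2 = select-∨-↭ (range 0 n) (All.map (h1 _) range-bounded) (All.map (h2 _) range-bounded)

  vertsWhere-sound : ∀ Q → All (λ v → Q v ≡ true × v < n) (vertsWhere Q)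
  vertsWhere-sound Q = All.zipWith (λ x → x) (select-true Q (range 0 n) , select-All Q _ (range 0 n) range-bounded)

  vertsWhere-complete : ∀ Q x → x < n → Q x ≡ true → x ∈ vertsWhere Q
  vertsWhere-complete Q x l e = select-∈ Q (range 0 n) x (range-∈ 0 n x z≤n l) e

  vertsWhere-single : ∀ b → b < n → vertsWhere (λ v → v ≡ᵇ b) ≡ b ∷ []
  vertsWhere-single b l = select-range-single b 0 n z≤n l

  vertsWhere-empty : ∀ {Q} → (∀ v → v < n → Q v ≡ false) → vertsWhere Q ≡ []
  vertsWhere-empty {Q} h = trans (vertsWhere-cong {Q} {λ _ → false} h) (select-false (range 0 n))

  vertsWhere-sorted : ∀ L → SortedFrom 0 L → All (λ v → v < n) L → vertsWhere (λ v → v ∈ᵇ L) ≡ L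
  vertsWhere-sorted L h b = select-range-sorted 0 n L h b

  vertsWhere-∧ : ∀ Q1 Q2 → vertsWhere (λ v → Q2 v ∧ Q1 v) ≡ select Q1 (vertsWhere Q2)
  vertsWhere-∧ Q1 Q2 = sym (select-select Q1 Q2 (range 0 n))

range-sorted : ∀ k m → SortedFrom k (range k m)
range-sorted k zero = tt
range-sorted k (suc m) = ≤-refl , range-sorted (suc k) m

-- inArc i j v: v lies strictly inside the counterclockwise arc from i to j of the polygon
-- 0, 1, …, n - 1; for i = j this is every vertex other than i.
inArc : ℕ → ℕ → ℕ → Bool
inArc i j v = if i <ᵇ j then (i <ᵇ v) ∧ (v <ᵇ j) else ((i <ᵇ v) ∨ (v <ᵇ j))

Outside : ℕ → ℕ → ℕ → Set
Outside a b v = v ≤ a ⊎ b ≤ v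

inArc-source : ∀ i j → inArc i j i ≡ false
inArc-source i j with <⊎≥ i j
... | inj₁ l rewrite <⇒<ᵇ-true l | <ᵇ-irrefl {i} = refl
... | inj₂ g rewrite ≥⇒<ᵇ-false g | <ᵇ-irrefl {i} = refl

inArc-target : ∀ i j → inArc i j j ≡ false
inArc-target i j with <⊎≥ i j
... | inj₁ l rewrite <⇒<ᵇ-true l | <ᵇ-irrefl {j} = refl
... | inj₂ g rewrite ≥⇒<ᵇ-false g | <ᵇ-irrefl {j} = refl

module _ (a b : ℕ) where
  Covers : ℕ → ℕ → Set
  Covers i j = ∀ v → a < v → v < b → inArc i j v ≡ true
  Misses : ℕ → ℕ → Set
  Misses i j = ∀ v → a ≤ v → v ≤ b → inArc i j v ≡ false

  covers-< : ∀ {i j} → i < j → i ≤ a → b ≤ j → Covers i j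
  covers-< {i} {j} l ia bj v av vb rewrite <⇒<ᵇ-true l | <⇒<ᵇ-true (≤-<-trans ia av) | <⇒<ᵇ-true (<-≤-trans vb bj) = refl

  covers-≥ : ∀ {i j} → j ≤ i → (i ≤ a ⊎ b ≤ j) → Covers i j
  covers-≥ {i} {j} g (inj₁ ia) v av vb rewrite ≥⇒<ᵇ-false g | <⇒<ᵇ-true (≤-<-trans ia av) = refl
  covers-≥ {i} {j} g (inj₂ bj) v av vb rewrite ≥⇒<ᵇ-false g | <⇒<ᵇ-true (<-≤-trans vb bj) = ∨-zeroʳ _

  misses-< : ∀ {i j} → i < j → (j ≤ a ⊎ b ≤ i) → Misses i j
  misses-< {i} {j} l (inj₁ ja) v av vb rewrite <⇒<ᵇ-true l | ≥⇒<ᵇ-false (≤-trans ja av) = ∧-zeroʳ _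
  misses-< {i} {j} l (inj₂ bi) v av vb rewrite <⇒<ᵇ-true l | ≥⇒<ᵇ-false (≤-trans vb bi) = refl

  misses-≥ : ∀ {i j} → j ≤ i → b ≤ i → j ≤ a → Misses i j
  misses-≥ {i} {j} g bi ja v av vb rewrite ≥⇒<ᵇ-false g | ≥⇒<ᵇ-false (≤-trans vb bi) | ≥⇒<ᵇ-false (≤-trans ja av) = refl

  covers⊎misses : ∀ i j → a < b → Outside a b i → Outside a b j → i ≢ j → (Covers i j × Misses j i) ⊎ (Covers j i × Misses i j)
  covers⊎misses i j ab (inj₁ ia) (inj₁ ja) ne with <-cmp i j
  ... | tri< l _ _ = inj₂ (covers-≥ (<⇒≤ l) (inj₁ ja) , misses-< l (inj₁ ja))
  ... | tri≈ _ e _ = ⊥-elim (ne e)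
  ... | tri> _ _ g = inj₁ (covers-≥ (<⇒≤ g) (inj₁ ia) , misses-< g (inj₁ ia))
  covers⊎misses i j ab (inj₁ ia) (inj₂ bj) ne = inj₁ (covers-< (≤-<-trans ia (<-≤-trans ab bj)) ia bj , misses-≥ (≤-trans ia (≤-trans (<⇒≤ ab) bj)) bj ia)
  covers⊎misses i j ab (inj₂ bi) (inj₁ ja) ne = inj₂ (covers-< (≤-<-trans ja (<-≤-trans ab bi)) ja bi , misses-≥ (≤-trans ja (≤-trans (<⇒≤ ab) bi)) bi ja)
  covers⊎misses i j ab (inj₂ bi) (inj₂ bj) ne with <-cmp i j
  ... | tri< l _ _ = inj₂ (covers-≥ (<⇒≤ l) (inj₂ bi) , misses-< l (inj₂ bi))
  ... | tri≈ _ e _ = ⊥-elim (ne e)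
  ... | tri> _ _ g = inj₁ (covers-≥ (<⇒≤ g) (inj₂ bj) , misses-< g (inj₂ bj))

  covers-loop : ∀ i → Outside a b i → Covers i i
  covers-loop i o = covers-≥ ≤-refl o

  inArc-shift-source : ∀ {i j v} → a < i → i < b → Outside a b j → Outside a b v → inArc i j v ≡ inArc a j v
  inArc-shift-source {i} {j} {v} ai ib (inj₁ ja) (inj₁ va) rewrite ≥⇒<ᵇ-false (≤-trans ja (<⇒≤ ai)) | ≥⇒<ᵇ-false ja | ≥⇒<ᵇ-false (≤-trans va (<⇒≤ ai)) | ≥⇒<ᵇ-false va = refl
  inArc-shift-source {i} {j} {v} ai ib (inj₁ ja) (inj₂ bv) rewrite ≥⇒<ᵇ-false (≤-trans ja (<⇒≤ ai)) | ≥⇒<ᵇ-false ja | <⇒<ᵇ-true (<-≤-trans ib bv) | <⇒<ᵇ-true (<-trans ai (<-≤-trans ib bv)) = refl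
  inArc-shift-source {i} {j} {v} ai ib (inj₂ bj) (inj₁ va) rewrite <⇒<ᵇ-true (<-≤-trans ib bj) | <⇒<ᵇ-true (<-trans ai (<-≤-trans ib bj)) | ≥⇒<ᵇ-false (≤-trans va (<⇒≤ ai)) | ≥⇒<ᵇ-false va = refl
  inArc-shift-source {i} {j} {v} ai ib (inj₂ bj) (inj₂ bv) rewrite <⇒<ᵇ-true (<-≤-trans ib bj) | <⇒<ᵇ-true (<-trans ai (<-≤-trans ib bj)) | <⇒<ᵇ-true (<-≤-trans ib bv) | <⇒<ᵇ-true (<-trans ai (<-≤-trans ib bv)) = refl

  inArc-shift-target : ∀ {i j v} → a < i → i < b → Outside a b j → Outside a b v → inArc j i v ≡ inArc j b v
  inArc-shift-target {i} {j} {v} ai ib (inj₁ ja) (inj₁ va) rewrite <⇒<ᵇ-true (≤-<-trans ja ai) | <⇒<ᵇ-true (≤-<-trans ja (<-trans ai ib)) | <⇒<ᵇ-true (≤-<-trans va ai) | <⇒<ᵇ-true (≤-<-trans va (<-trans ai ib)) = refl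
  inArc-shift-target {i} {j} {v} ai ib (inj₁ ja) (inj₂ bv) rewrite <⇒<ᵇ-true (≤-<-trans ja ai) | <⇒<ᵇ-true (≤-<-trans ja (<-trans ai ib)) | ≥⇒<ᵇ-false (≤-trans (<⇒≤ ib) bv) | ≥⇒<ᵇ-false bv = refl
  inArc-shift-target {i} {j} {v} ai ib (inj₂ bj) (inj₁ va) rewrite ≥⇒<ᵇ-false (≤-trans (<⇒≤ ib) bj) | ≥⇒<ᵇ-false bj | <⇒<ᵇ-true (≤-<-trans va ai) | <⇒<ᵇ-true (≤-<-trans va (<-trans ai ib)) = refl
  inArc-shift-target {i} {j} {v} ai ib (inj₂ bj) (inj₂ bv) rewrite ≥⇒<ᵇ-false (≤-trans (<⇒≤ ib) bj) | ≥⇒<ᵇ-false bj | ≥⇒<ᵇ-false (≤-trans (<⇒≤ ib) bv) | ≥⇒<ᵇ-false bv = refl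

  inArc-split-source : ∀ {j v} → a < b → Outside a b j → j ≢ b → Outside a b v → inArc a j v ≡ ((v ≡ᵇ b) ∨ inArc b j v)
  inArc-split-source {j} {v} ab (inj₁ ja) nb (inj₁ va) rewrite ≥⇒<ᵇ-false ja | ≥⇒<ᵇ-false (≤-trans ja (<⇒≤ ab)) | ≥⇒<ᵇ-false va | ≢⇒≡ᵇ-false {v} {b} (λ e → <⇒≱ ab (subst (_≤ a) e va)) | ≥⇒<ᵇ-false (≤-trans va (<⇒≤ ab)) = refl
  inArc-split-source {j} {v} ab (inj₁ ja) nb (inj₂ bv) rewrite ≥⇒<ᵇ-false ja | ≥⇒<ᵇ-false (≤-trans ja (<⇒≤ ab)) | <⇒<ᵇ-true (<-≤-trans ab bv) with ≡⊎≢ v b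
  ... | inj₁ refl rewrite ≡ᵇ-refl v = refl
  ... | inj₂ ne rewrite ≢⇒≡ᵇ-false ne | <⇒<ᵇ-true (≤∧≢⇒< bv (λ e → ne (sym e))) = refl
  inArc-split-source {j} {v} ab (inj₂ bj) nb (inj₁ va) rewrite <⇒<ᵇ-true (<-≤-trans ab bj) | <⇒<ᵇ-true (≤∧≢⇒< bj (λ e → nb (sym e))) | ≥⇒<ᵇ-false va | ≢⇒≡ᵇ-false {v} {b} (λ e → <⇒≱ ab (subst (_≤ a) e va)) | ≥⇒<ᵇ-false (≤-trans va (<⇒≤ ab)) = refl
  inArc-split-source {j} {v} ab (inj₂ bj) nb (inj₂ bv) rewrite <⇒<ᵇ-true (<-≤-trans ab bj) | <⇒<ᵇ-true (≤∧≢⇒< bj (λ e → nb (sym e))) | <⇒<ᵇ-true (<-≤-trans ab bv) with ≡⊎≢ v b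
  ... | inj₁ refl rewrite ≡ᵇ-refl v | <⇒<ᵇ-true (≤∧≢⇒< bj (λ e → nb (sym e))) = refl
  ... | inj₂ ne rewrite ≢⇒≡ᵇ-false ne | <⇒<ᵇ-true (≤∧≢⇒< bv (λ e → ne (sym e))) = refl

  inArc-split-target : ∀ {j v} → a < b → Outside a b j → j ≢ a → Outside a b v → inArc j b v ≡ (inArc j a v ∨ (v ≡ᵇ a))
  inArc-split-target {j} {v} ab (inj₁ ja) na (inj₁ va) rewrite <⇒<ᵇ-true (≤-<-trans ja ab) | <⇒<ᵇ-true (≤∧≢⇒< ja na) | <⇒<ᵇ-true (≤-<-trans va ab) with ≡⊎≢ v a
  ... | inj₁ refl rewrite ≡ᵇ-refl v | <⇒<ᵇ-true (≤∧≢⇒< ja na) = sym (∨-zeroʳ _)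
  ... | inj₂ ne rewrite ≢⇒≡ᵇ-false ne | <⇒<ᵇ-true (≤∧≢⇒< va ne) = sym (∨-identityʳ _)
  inArc-split-target {j} {v} ab (inj₁ ja) na (inj₂ bv) rewrite <⇒<ᵇ-true (≤-<-trans ja ab) | <⇒<ᵇ-true (≤∧≢⇒< ja na) | ≥⇒<ᵇ-false bv | ≥⇒<ᵇ-false (≤-trans (<⇒≤ ab) bv) | ≢⇒≡ᵇ-false {v} {a} (λ e → <⇒≱ ab (subst (b ≤_) e bv)) = trans (∧-zeroʳ _) (sym (trans (∨-identityʳ _) (∧-zeroʳ _)))
  inArc-split-target {j} {v} ab (inj₂ bj) na (inj₁ va) rewrite ≥⇒<ᵇ-false bj | ≥⇒<ᵇ-false (≤-trans (<⇒≤ ab) bj) | <⇒<ᵇ-true (≤-<-trans va ab) with ≡⊎≢ v a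
  ... | inj₁ refl rewrite ≡ᵇ-refl v = trans (∨-zeroʳ _) (sym (∨-zeroʳ _))
  ... | inj₂ ne rewrite ≢⇒≡ᵇ-false ne | <⇒<ᵇ-true (≤∧≢⇒< va ne) = trans (∨-zeroʳ _) (sym (trans (∨-identityʳ _) (∨-zeroʳ _)))
  inArc-split-target {j} {v} ab (inj₂ bj) na (inj₂ bv) rewrite ≥⇒<ᵇ-false bj | ≥⇒<ᵇ-false (≤-trans (<⇒≤ ab) bj) | ≥⇒<ᵇ-false bv | ≥⇒<ᵇ-false (≤-trans (<⇒≤ ab) bv) | ≢⇒≡ᵇ-false {v} {a} (λ e → <⇒≱ ab (subst (b ≤_) e bv)) = sym (∨-identityʳ _)

  inArc-around : ∀ {i j v} → a < i → j < b → i ≤ j → Outside a b v → inArc j i v ≡ true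
  inArc-around {i} {j} {v} ai jb ij (inj₁ va) rewrite ≥⇒<ᵇ-false ij | <⇒<ᵇ-true (≤-<-trans va ai) = ∨-zeroʳ _
  inArc-around {i} {j} {v} ai jb ij (inj₂ bv) rewrite ≥⇒<ᵇ-false ij | <⇒<ᵇ-true (<-≤-trans jb bv) = refl

  inArc-within : ∀ {i j v} → a ≤ i → j ≤ b → i < j → Outside a b v → inArc i j v ≡ false
  inArc-within {i} {j} {v} ai jb ij (inj₁ va) rewrite <⇒<ᵇ-true ij | ≥⇒<ᵇ-false (≤-trans va ai) = refl
  inArc-within {i} {j} {v} ai jb ij (inj₂ bv) rewrite <⇒<ᵇ-true ij | ≥⇒<ᵇ-false (≤-trans jb bv) = ∧-zeroʳ _

  inArc-outside : ∀ {v} → a < b → Outside a b v → ((v ≡ᵇ b) ∨ ((v ≡ᵇ a) ∨ inArc b a v)) ≡ true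
  inArc-outside {v} ab (inj₁ va) rewrite ≥⇒<ᵇ-false (<⇒≤ ab) | ≢⇒≡ᵇ-false {v} {b} (λ e → <⇒≱ ab (subst (_≤ a) e va)) with ≡⊎≢ v a
  ... | inj₁ refl rewrite ≡ᵇ-refl v = refl
  ... | inj₂ ne rewrite ≢⇒≡ᵇ-false ne | <⇒<ᵇ-true (≤∧≢⇒< va ne) = ∨-zeroʳ _
  inArc-outside {v} ab (inj₂ bv) rewrite ≥⇒<ᵇ-false (<⇒≤ ab) with ≡⊎≢ v b
  ... | inj₁ refl rewrite ≡ᵇ-refl v = refl
  ... | inj₂ ne rewrite ≢⇒≡ᵇ-false ne | ≢⇒≡ᵇ-false {v} {a} (λ e → <⇒≱ ab (subst (b ≤_) e bv)) | <⇒<ᵇ-true (≤∧≢⇒< bv (λ e → ne (sym e))) = refl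

  inArc-source-skips : ∀ {j} → a < b → Outside a b j → j ≢ b → inArc b j a ≡ false
  inArc-source-skips {j} ab (inj₁ ja) nb rewrite ≥⇒<ᵇ-false (≤-trans ja (<⇒≤ ab)) | ≥⇒<ᵇ-false (<⇒≤ ab) | ≥⇒<ᵇ-false ja = refl
  inArc-source-skips {j} ab (inj₂ bj) nb rewrite <⇒<ᵇ-true (≤∧≢⇒< bj (λ e → nb (sym e))) | ≥⇒<ᵇ-false (<⇒≤ ab) = refl

  inArc-target-skips : ∀ {j} → a < b → Outside a b j → j ≢ a → inArc j a b ≡ false
  inArc-target-skips {j} ab (inj₁ ja) na rewrite <⇒<ᵇ-true (≤∧≢⇒< ja na) | ≥⇒<ᵇ-false (<⇒≤ ab) = ∧-zeroʳ _
  inArc-target-skips {j} ab (inj₂ bj) na rewrite ≥⇒<ᵇ-false (≤-trans (<⇒≤ ab) bj) | ≥⇒<ᵇ-false bj | ≥⇒<ᵇ-false (<⇒≤ ab) = refl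

inArc-loop : ∀ {i v} → v ≢ i → inArc i i v ≡ true
inArc-loop {i} {v} ne rewrite <ᵇ-irrefl {i} with <-cmp i v
... | tri< l _ _ rewrite <⇒<ᵇ-true l = refl
... | tri≈ _ e _ = ⊥-elim (ne (sym e))
... | tri> _ _ g rewrite <⇒<ᵇ-true g = ∨-zeroʳ _

module Walks (n : ℕ) where
  open Vertices n

  vertsWhere-range : ∀ Q k m → k + m ≤ n → (∀ v → v < n → Q v ≡ true → (k ≤ v) × (v < k + m)) → (∀ v → k ≤ v → v < k + m → Q v ≡ true) → vertsWhere Q ≡ range k m
  vertsWhere-range Q k m km sound complete =
    trans (vertsWhere-cong (λ v l → bool-ext (λ q → let b = sound v l q in ∈⇒∈ᵇ v (range k m) (range-∈ k m v (proj₁ b) (proj₂ b)))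
                                    (λ i → let b = All.lookup (range-bounds k m) (∈ᵇ⇒∈ v (range k m) i) in complete v (proj₁ b) (proj₂ b))))
          (vertsWhere-sorted (range k m) (SortedFrom-weaken (range k m) z≤n (range-sorted k m)) (All.map (λ {v} b → <-≤-trans (proj₂ b) km) (range-bounds k m)))

  next-step : ∀ k → suc k < n → next n k ≡ suc k
  next-step k l = cong (λ b → if b then 0 else suc k) (≢⇒≡ᵇ-false (<⇒≢ l))

  next-wrap : ∀ k → suc k ≡ n → next n k ≡ 0
  next-wrap k e = cong (λ b → if b then 0 else suc k) (trans (cong (_≡ᵇ n) e) (≡ᵇ-refl n))

  walk-step : ∀ f k j x → next n k ≡ x → walk n (suc f) k j ≡ (if x ≡ᵇ j then [] else x ∷ walk n f x j)
  walk-step f k j .(next n k) refl = refl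

  walk-run : ∀ j t f k → t ≤ f → (∀ s → s < t → (suc (k + s) < n) × (suc (k + s) ≢ j)) →
    walk n f k j ≡ range (suc k) t ++ walk n (f ∸ t) (k + t) j
  walk-run j zero f k _ _ = cong (λ z → walk n f z j) (sym (+-identityʳ k))
  walk-run j (suc t) (suc f) k (s≤s le) steps =
    trans (walk-step f k j (suc k) (next-step k k+1<n))
      (trans (cong (λ b → if b then [] else suc k ∷ walk n f (suc k) j) (≢⇒≡ᵇ-false k+1≢j))
        (cong (suc k ∷_) (trans (walk-run j t f (suc k) le later) (cong (λ z → range (suc (suc k)) t ++ walk n (f ∸ t) z j) (sym (+-suc k t))))))
    where
    first = steps 0 (s≤s z≤n)
    k+1<n : suc k < n
    k+1<n = subst (λ z → suc z < n) (+-identityʳ k) (proj₁ first)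
    k+1≢j : suc k ≢ j
    k+1≢j = subst (λ z → suc z ≢ j) (+-identityʳ k) (proj₂ first)
    later : ∀ s → s < t → (suc (suc k + s) < n) × (suc (suc k + s) ≢ j)
    later s l = subst (λ z → (suc z < n) × (suc z ≢ j)) (+-suc k s) (steps (suc s) (s≤s l))

  m∸n≡1+[m∸1+n] : ∀ t m → t < m → m ∸ t ≡ suc (m ∸ suc t)
  m∸n≡1+[m∸1+n] zero (suc m) _ = refl
  m∸n≡1+[m∸1+n] (suc t) (suc m) (s≤s l) = m∸n≡1+[m∸1+n] t m l

  walk-stop : ∀ f k j → next n k ≡ j → walk n (suc f) k j ≡ []
  walk-stop f k j e = trans (walk-step f k j j e) (cong (λ b → if b then [] else j ∷ walk n f j j) (≡ᵇ-refl j))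

  between-< : ∀ i j → i < j → j < n → between n i j ≡ range (suc i) (j ∸ suc i)
  between-< i j ij jn =
    trans (walk-run j t n i (≤-trans (m∸n≤m j (suc i)) (<⇒≤ jn)) steps)
      (trans (cong (λ f → range (suc i) t ++ walk n f (i + t) j) (m∸n≡1+[m∸1+n] t n t<n))
        (trans (cong (range (suc i) t ++_) (walk-stop (n ∸ suc t) (i + t) j (trans (next-step (i + t) (subst (_< n) (sym i+t+1≡j) jn)) i+t+1≡j)))
          (++-identityʳ _)))
    where
    t : ℕ
    t = j ∸ suc i
    i+t+1≡j : suc (i + t) ≡ j
    i+t+1≡j = m+[n∸m]≡n ij
    t<n : t < n
    t<n = ≤-trans (s≤s (m∸n≤m j (suc i))) jn
    steps : ∀ s → s < t → (suc (i + s) < n) × (suc (i + s) ≢ j)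
    steps s l = let a = subst (suc (i + s) <_) i+t+1≡j (s≤s (+-monoʳ-< i l)) in <-trans a jn , <⇒≢ a

  between-≥ : ∀ i j → j ≤ i → i < n → between n i j ≡ range (suc i) (n ∸ suc i) ++ range 0 j
  between-≥ i j ji inn =
    trans (walk-run j t1 n i (m∸n≤m n (suc i)) steps)
      (cong (range (suc i) t1 ++_)
        (trans (cong (λ f → walk n f (i + t1) j) (m∸[m∸n]≡n inn))
          (trans (walk-step i (i + t1) j 0 (next-wrap (i + t1) i+t+1≡n)) (wrap j ji))))
    where
    t1 : ℕ
    t1 = n ∸ suc i
    i+t+1≡n : suc (i + t1) ≡ n
    i+t+1≡n = m+[n∸m]≡n inn
    steps : ∀ s → s < t1 → (suc (i + s) < n) × (suc (i + s) ≢ j)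
    steps s l = subst (suc (i + s) <_) i+t+1≡n (s≤s (+-monoʳ-< i l)) , (λ e → <⇒≱ (s≤s (m≤m+n i s)) (subst (_≤ i) (sym e) ji))
    wrap : ∀ j → j ≤ i → (if 0 ≡ᵇ j then [] else 0 ∷ walk n i 0 j) ≡ range 0 j
    wrap zero _ = refl
    wrap (suc j') jl =
      cong (0 ∷_) (trans (walk-run (suc j') j' i 0 (≤-trans (n≤1+n j') jl) steps′)
        (trans (cong (λ f → range 1 j' ++ walk n f j' (suc j')) (m∸n≡1+[m∸1+n] j' i jl))
          (trans (cong (range 1 j' ++_) (walk-stop (i ∸ suc j') j' (suc j') (next-step j' (≤-<-trans jl inn)))) (++-identityʳ _))))
      where
      steps′ : ∀ s → s < j' → (suc s < n) × (suc s ≢ suc j')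
      steps′ s l = <-trans (s≤s l) (≤-<-trans jl inn) , (λ e → <⇒≢ (s≤s l) e)

  vertsWhere-inArc-< : ∀ i j → i < j → j < n → vertsWhere (inArc i j) ≡ range (suc i) (j ∸ suc i)
  vertsWhere-inArc-< i j ij jn = vertsWhere-range (inArc i j) (suc i) (j ∸ suc i) (subst (_≤ n) (sym i+t+1≡j) (<⇒≤ jn)) sound complete
    where
    i+t+1≡j : suc (i + (j ∸ suc i)) ≡ j
    i+t+1≡j = m+[n∸m]≡n ij
    sound : ∀ v → v < n → inArc i j v ≡ true → (suc i ≤ v) × (v < suc i + (j ∸ suc i))
    sound v vn c rewrite <⇒<ᵇ-true ij = let b = ∧-true⇒ {i <ᵇ v} c in <ᵇ-true⇒< (proj₁ b) , subst (v <_) (sym i+t+1≡j) (<ᵇ-true⇒< (proj₂ b))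
    complete : ∀ v → suc i ≤ v → v < suc i + (j ∸ suc i) → inArc i j v ≡ true
    complete v l u rewrite <⇒<ᵇ-true ij | <⇒<ᵇ-true l | <⇒<ᵇ-true (subst (v <_) i+t+1≡j u) = refl

  between↭arc : ∀ i j → i < n → j < n → between n i j ↭ vertsWhere (inArc i j)
  between↭arc i j inn jn with <⊎≥ i j
  ... | inj₁ ij = Perm.↭-reflexive (trans (between-< i j ij jn) (sym (vertsWhere-inArc-< i j ij jn)))
  ... | inj₂ ji = Perm.↭-sym (Perm.trans (vertsWhere-∨-↭ {Q1 = λ v → i <ᵇ v} {Q2 = λ v → v <ᵇ j} inArc-wrap disjoint)
                     (Perm.↭-reflexive (trans (cong₂ _++_ upper lower) (sym (between-≥ i j ji inn)))))
    where
    inArc-wrap : ∀ v → v < n → inArc i j v ≡ ((i <ᵇ v) ∨ (v <ᵇ j))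
    inArc-wrap v _ rewrite ≥⇒<ᵇ-false ji = refl
    disjoint : ∀ v → v < n → ((i <ᵇ v) ∧ (v <ᵇ j)) ≡ false
    disjoint v _ with <⊎≥ i v
    ... | inj₁ l rewrite <⇒<ᵇ-true l | ≥⇒<ᵇ-false (≤-trans ji (<⇒≤ l)) = refl
    ... | inj₂ g rewrite ≥⇒<ᵇ-false g = refl
    upper : vertsWhere (λ v → i <ᵇ v) ≡ range (suc i) (n ∸ suc i)
    upper = vertsWhere-range _ (suc i) (n ∸ suc i) (≤-reflexive (m+[n∸m]≡n inn)) (λ v vn c → <ᵇ-true⇒< c , subst (v <_) (sym (m+[n∸m]≡n inn)) vn) (λ v l u → <⇒<ᵇ-true l)
    lower : vertsWhere (λ v → v <ᵇ j) ≡ range 0 j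
    lower = vertsWhere-range _ 0 j (≤-trans (<⇒≤ (≤-<-trans ji inn)) ≤-refl) (λ v vn c → z≤n , <ᵇ-true⇒< c) (λ v l u → <⇒<ᵇ-true u)

Within : (ℕ → Bool) → Pool → Set
Within P st = All (λ cr → ∀ w → w ∈ᵇ proj₁ cr ≡ true → P w ≡ true) st

module EarStep (n d : ℕ) where
  open Vertices n

  arc : (ℕ → Bool) → ℕ → ℕ → List ℕ
  arc P i j = vertsWhere (λ v → P v ∧ inArc i j v)

  -- The induction invariant for the sub-polygon with vertex set P, filled by the cells of st.
  Symmetric : (ℕ → Bool) → Pool → Set
  Symmetric P st = (∀ i j → i < n → j < n → P i ≡ true → P j ≡ true → assignments st (arc P i j) ≡ assignments st (arc P j i))
           × (∀ i → i < n → P i ≡ true → assignments st (arc P i i) ≡ 0)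

  Symmetric-cong : ∀ {P Q} st → (∀ v → v < n → P v ≡ Q v) → Symmetric P st → Symmetric Q st
  Symmetric-cong {P} {Q} st h (s , z) =
    (λ i j il jl qi qj → trans (cong (assignments st) (ac i j)) (trans (s i j il jl (trans (h i il) qi) (trans (h j jl) qj)) (sym (cong (assignments st) (ac j i)))))
    , (λ i il qi → trans (cong (assignments st) (ac i i)) (z i il (trans (h i il) qi)))
    where
    ac : ∀ i j → arc Q i j ≡ arc P i j
    ac i j = vertsWhere-cong (λ v l → cong (_∧ inArc i j v) (sym (h v l)))

  -- Gluing the d-gon E onto the side {a, b} of the sub-polygon P: its other (fresh) vertices
  -- lie strictly between a and b, and it may be used d - 2 times.
  module Ear (P : ℕ → Bool) (st : Pool) (a b : ℕ) (E : List ℕ)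
    (a<b : a < b) (b<n : b < n) (a∈P : P a ≡ true) (b∈P : P b ≡ true)
    (gap : ∀ v → a < v → v < b → P v ≡ false)
    (P-bounded : ∀ v → P v ≡ true → v < n)
    (a∈E : a ∈ᵇ E ≡ true) (b∈E : b ∈ᵇ E ≡ true)
    (E-verts : ∀ v → v ∈ᵇ E ≡ true → (v ≡ a) ⊎ (v ≡ b) ⊎ ((a < v) × (v < b)))
    (within : Within P st)
    where

    fresh : ℕ → Bool
    fresh v = v ∈ᵇ E ∧ ((a <ᵇ v) ∧ (v <ᵇ b))

    P⁺ : ℕ → Bool
    P⁺ v = P v ∨ fresh v

    cap : ℕ
    cap = d ∸ 2

    st⁺ : Pool
    st⁺ = st ∷ʳ (E , cap)

    fresh-between : ∀ {v} → fresh v ≡ true → (a < v) × (v < b) × (v ∈ᵇ E ≡ true)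
    fresh-between {v} e with ∧-true⇒ {(v ∈ᵇ E)} e
    ... | (i , e2) with ∧-true⇒ {a <ᵇ v} e2
    ... | (l , u) = <ᵇ-true⇒< l , <ᵇ-true⇒< u , i

    fresh-new : ∀ {v} → fresh v ≡ true → P v ≡ false
    fresh-new e with fresh-between e
    ... | (l , u , _) = gap _ l u

    old-outside : ∀ {v} → P v ≡ true → Outside a b v
    old-outside {v} p with <⊎≥ a v
    ... | inj₂ g = inj₁ g
    ... | inj₁ l with <⊎≥ v b
    ... | inj₁ u = ⊥-elim (true≢false (trans (sym p) (gap v l u)))
    ... | inj₂ g = inj₂ g

    outside-∈E : ∀ {v} → Outside a b v → v ∈ᵇ E ≡ true → (v ≡ a) ⊎ (v ≡ b)
    outside-∈E o i with E-verts _ i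
    ... | inj₁ e = inj₁ e
    ... | inj₂ (inj₁ e) = inj₂ e
    ... | inj₂ (inj₂ (l , u)) with o
    ... | inj₁ va = ⊥-elim (<⇒≱ l va)
    ... | inj₂ bv = ⊥-elim (<⇒≱ u bv)

    fresh-intro : ∀ {v} → a < v → v < b → v ∈ᵇ E ≡ true → fresh v ≡ true
    fresh-intro l u i rewrite i | <⇒<ᵇ-true l | <⇒<ᵇ-true u = refl

    new-avoids : ∀ {v} → P v ≡ false → Avoids v st
    new-avoids {v} pf = All.map (λ {cr} h → ≢true⇒≡false (λ i → true≢false (trans (sym (h v i)) pf))) within

    old-∉E : ∀ {v} → P v ≡ true → v ≢ a → v ≢ b → v ∈ᵇ E ≡ false
    old-∉E {v} p na nb = ≢true⇒≡false (λ i → case (outside-∈E (old-outside p) i))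
      where case : (v ≡ a) ⊎ (v ≡ b) → ⊥
            case (inj₁ e) = na e
            case (inj₂ e) = nb e

    old-arc-∉E : ∀ x y → inArc x y a ≡ false → inArc x y b ≡ false → All (λ w → w ∈ᵇ E ≡ false) (arc P x y)
    old-arc-∉E x y a∉ b∉ = All.map (λ {w} h → let pc = ∧-true⇒ {P w} (proj₁ h) in
      old-∉E (proj₁ pc) (λ { refl → true≢false (trans (sym (proj₂ pc)) a∉) })
                        (λ { refl → true≢false (trans (sym (proj₂ pc)) b∉) })) (vertsWhere-sound _)

    freshVerts : List ℕ
    freshVerts = vertsWhere fresh

    module _ (freshCount : length freshVerts ≡ cap) where

      freshIn : (ℕ → Bool) → List ℕ
      freshIn C = vertsWhere (λ v → fresh v ∧ C v)

      freshOut : (ℕ → Bool) → List ℕ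
      freshOut C = select (λ v → not (C v)) freshVerts

      freshIn-select : ∀ C → freshIn C ≡ select C freshVerts
      freshIn-select C = vertsWhere-∧ C fresh

      freshIn-spare : ∀ C → cap ∸ length (freshIn C) ≡ length (freshOut C)
      freshIn-spare C rewrite freshIn-select C = trans (cong (_∸ length (select C freshVerts)) (trans (sym freshCount) (sym (length-select-not C freshVerts)))) (m+n∸m≡n (length (select C freshVerts)) (length (freshOut C)))

      freshIn-≤ : ∀ C → length (freshIn C) ≤ cap
      freshIn-≤ C rewrite freshIn-select C = subst (length (select C freshVerts) ≤_) (trans (length-select-not C freshVerts) freshCount) (m≤m+n _ _)

      freshIn-private : ∀ C → All (λ v → v ∈ᵇ E ≡ true × Avoids v st) (freshIn C)
      freshIn-private C = All.map (λ {v} h → let e = proj₁ (∧-true⇒ {fresh v} (proj₁ h)) in proj₂ (proj₂ (fresh-between e)) , new-avoids (fresh-new e)) (vertsWhere-sound _)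

      freshOut-∈ : ∀ C x → x < n → fresh x ≡ true → C x ≡ false → x ∈ freshOut C
      freshOut-∈ C x l e c = select-∈ _ freshVerts x (vertsWhere-complete fresh x l e) (≡false⇒not≡true c)

      assignments-freshIn : ∀ C X → assignments st⁺ (freshIn C ++ X) ≡ assignments (st ∷ʳ (E , length (freshOut C))) X
      assignments-freshIn C X = trans (assignments-∷ʳ-private E st (freshIn C) X cap (freshIn-private C) (freshIn-≤ C)) (cong (λ z → assignments (st ∷ʳ (E , z)) X) (freshIn-spare C))

      arc-split : ∀ x (Q Q' : ℕ → Bool) → P x ≡ true → x < n → (∀ v → P v ≡ true → Q v ≡ ((v ≡ᵇ x) ∨ Q' v)) → Q' x ≡ false →
        vertsWhere (λ v → P v ∧ Q v) ↭ x ∷ vertsWhere (λ v → P v ∧ Q' v)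
      arc-split x Q Q' px xl h qx =
        Perm.trans (vertsWhere-∨-↭ (λ v l → split-vertex (P v) (Q v) (Q' v) (v ≡ᵇ x) (h v) (λ e → subst (λ z → P z ≡ true) (sym (≡ᵇ-true⇒≡ e)) px))
                            (λ v l → disjoint-vertex (P v) (Q' v) (v ≡ᵇ x) (λ e → subst (λ z → Q' z ≡ false) (sym (≡ᵇ-true⇒≡ e)) qx)))
                   (Perm.↭-reflexive (cong (_++ _) (vertsWhere-single x xl)))

      module _ (sym′ : Symmetric P st) where

        count count⁺ : List ℕ → ℕ
        count  = assignments st
        count⁺ = assignments st⁺

        arc′ arc⁺ : ℕ → ℕ → List ℕ
        arc′ = arc P
        arc⁺ = arc P⁺

        an : a < n
        an = <-trans a<b b<n

        arc-ab : arc′ a b ≡ []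
        arc-ab = vertsWhere-empty (λ v l → h v)
          where h : ∀ v → (P v ∧ inArc a b v) ≡ false
                h v with P v in p
                ... | true = inArc-within a b ≤-refl ≤-refl a<b (old-outside p)
                ... | false = refl

        count-ab : count (arc′ a b) ≡ 1
        count-ab rewrite arc-ab = refl

        count-ba : count (arc′ b a) ≡ 1
        count-ba = trans (sym (proj₁ sym′ a b an b<n a∈P b∈P)) count-ab

        count-aa : count (arc′ a a) ≡ 0
        count-aa = proj₂ sym′ a an a∈P

        count-bb : count (arc′ b b) ≡ 0
        count-bb = proj₂ sym′ b b<n b∈P

        a≢b : a ≢ b
        a≢b e = <⇒≢ a<b e

        R : List ℕ
        R = arc′ b a

        R∉E : All (λ w → w ∈ᵇ E ≡ false) R
        R∉E = old-arc-∉E b a (inArc-target b a) (inArc-source b a)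

        bb↭ : arc′ b b ↭ a ∷ R
        bb↭ = arc-split a (inArc b b) (inArc b a) a∈P an
          (λ v p → trans (inArc-split-target a b a<b (inj₂ ≤-refl) (λ e → a≢b (sym e)) (old-outside p)) (∨-comm (inArc b a v) _)) (inArc-target b a)

        aa↭ : arc′ a a ↭ b ∷ R
        aa↭ = arc-split b (inArc a a) (inArc b a) b∈P b<n (λ v p → inArc-split-source a b a<b (inj₁ ≤-refl) a≢b (old-outside p)) (inArc-source b a)

        count-aR : count (a ∷ R) ≡ 0
        count-aR = trans (sym (assignments-↭ bb↭ st)) count-bb

        count-bR : count (b ∷ R) ≡ 0
        count-bR = trans (sym (assignments-↭ aa↭ st)) count-aa

        -- The fresh vertices on such an arc use up all d - 2 uses of E.
        covered-arc : ∀ i j → Covers a b i j → count⁺ (arc⁺ i j) ≡ count (arc′ i j)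
        covered-arc i j cv =
          trans (assignments-↭ (vertsWhere-∨-↭ {Q1 = fresh} {Q2 = λ v → P v ∧ inArc i j v}
                   (λ v l → split-covered (P v) (fresh v) (inArc i j v) fresh-new (λ e → let h = fresh-between e in cv v (proj₁ h) (proj₁ (proj₂ h))))
                   (λ v l → disjoint-covered (P v) (fresh v) (inArc i j v) fresh-new)) st⁺)
            (trans (assignments-∷ʳ-private E st freshVerts (arc′ i j) cap fresh-private (≤-reflexive freshCount))
              (trans (cong (λ z → assignments (st ∷ʳ (E , z)) (arc′ i j)) (trans (cong (cap ∸_) freshCount) (n∸n≡0 cap))) (assignments-∷ʳ-0 E (arc′ i j) st)))
          where
          fresh-private : All (λ v → v ∈ᵇ E ≡ true × Avoids v st) freshVerts
          fresh-private = All.map (λ {v} h → proj₂ (proj₂ (fresh-between (proj₁ h))) , new-avoids (fresh-new (proj₁ h))) (vertsWhere-sound fresh)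

        missed-arc : ∀ x y → Misses a b x y → count⁺ (arc⁺ x y) ≡ count (arc′ x y)
        missed-arc x y em =
          trans (cong count⁺ (vertsWhere-cong (λ v l → split-missed (P v) (fresh v) (inArc x y v) (λ e → let h = fresh-between e in em v (<⇒≤ (proj₁ h)) (<⇒≤ (proj₁ (proj₂ h)))))))
            (assignments-∷ʳ-unused E cap (arc′ x y) (old-arc-∉E x y (em a ≤-refl (<⇒≤ a<b)) (em b (<⇒≤ a<b) ≤-refl)) st)

        -- As i is off the arc, E keeps a spare use, and of the old vertices only b can take it.
        ear-to-old : ∀ i j → fresh i ≡ true → i < n → P j ≡ true → count⁺ (arc⁺ i j) ≡ count (arc′ b j) + count (arc′ a j)
        ear-to-old i j ei il pj =
          trans (assignments-↭ (vertsWhere-∨-↭ {Q1 = λ v → fresh v ∧ inArc i j v} {Q2 = λ v → P v ∧ inArc a j v}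
                   (λ v l → split-mixed (P v) (fresh v) (inArc i j v) (inArc a j v) fresh-new (λ p → inArc-shift-source a b ai ib oj (old-outside p)))
                   (λ v l → disjoint-mixed (P v) (fresh v) (inArc i j v) (inArc a j v) fresh-new)) st⁺)
            (trans (assignments-freshIn (inArc i j) (arc′ a j)) (fin (length (freshOut (inArc i j))) (∈⇒length≥1 (freshOut-∈ (inArc i j) i il ei (inArc-source i j)))))
          where
          ai : a < i
          ai = proj₁ (fresh-between ei)
          ib : i < b
          ib = proj₁ (proj₂ (fresh-between ei))
          oj : Outside a b j
          oj = old-outside pj
          fin : ∀ m → 1 ≤ m → assignments (st ∷ʳ (E , m)) (arc′ a j) ≡ count (arc′ b j) + count (arc′ a j)
          fin (suc r) _ with ≡⊎≢ j b
          ... | inj₁ refl rewrite arc-ab | count-bb = refl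
          ... | inj₂ ne =
            trans (assignments-↭ pb (st ∷ʳ (E , suc r)))
              (trans (assignments-∷ʳ-head E st b (arc′ b j) (suc r) b∈E (old-arc-∉E b j (inArc-source-skips a b a<b oj ne) (inArc-source b j)))
                (trans (cong (_+ count (arc′ b j)) (sym (assignments-↭ pb st))) (+-comm (count (arc′ a j)) (count (arc′ b j)))))
            where
            pb : arc′ a j ↭ b ∷ arc′ b j
            pb = arc-split b (inArc a j) (inArc b j) b∈P b<n (λ v p → inArc-split-source a b a<b oj ne (old-outside p)) (inArc-source b j)

        old-to-ear : ∀ i j → fresh i ≡ true → i < n → P j ≡ true → count⁺ (arc⁺ j i) ≡ count (arc′ j a) + count (arc′ j b)
        old-to-ear i j ei il pj =
          trans (assignments-↭ (vertsWhere-∨-↭ {Q1 = λ v → fresh v ∧ inArc j i v} {Q2 = λ v → P v ∧ inArc j b v}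
                   (λ v l → split-mixed (P v) (fresh v) (inArc j i v) (inArc j b v) fresh-new (λ p → inArc-shift-target a b ai ib oj (old-outside p)))
                   (λ v l → disjoint-mixed (P v) (fresh v) (inArc j i v) (inArc j b v) fresh-new)) st⁺)
            (trans (assignments-freshIn (inArc j i) (arc′ j b)) (fin (length (freshOut (inArc j i))) (∈⇒length≥1 (freshOut-∈ (inArc j i) i il ei (inArc-target j i)))))
          where
          ai : a < i
          ai = proj₁ (fresh-between ei)
          ib : i < b
          ib = proj₁ (proj₂ (fresh-between ei))
          oj : Outside a b j
          oj = old-outside pj
          fin : ∀ m → 1 ≤ m → assignments (st ∷ʳ (E , m)) (arc′ j b) ≡ count (arc′ j a) + count (arc′ j b)
          fin (suc r) _ with ≡⊎≢ j a
          ... | inj₁ refl rewrite arc-ab | count-aa = refl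
          ... | inj₂ ne =
            trans (assignments-↭ pa (st ∷ʳ (E , suc r)))
              (trans (assignments-∷ʳ-head E st a (arc′ j a) (suc r) a∈E (old-arc-∉E j a (inArc-target j a) (inArc-target-skips a b a<b oj ne)))
                (trans (cong (_+ count (arc′ j a)) (sym (assignments-↭ pa st))) (+-comm (count (arc′ j b)) (count (arc′ j a)))))
            where
            pa : arc′ j b ↭ a ∷ arc′ j a
            pa = arc-split a (inArc j b) (inArc j a) a∈P an (λ v p → trans (inArc-split-target a b a<b oj ne (old-outside p)) (∨-comm (inArc j a v) _)) (inArc-target j a)

        aOrBack : ℕ → Bool
        aOrBack v = (v ≡ᵇ a) ∨ inArc b a v
        bOrAOrBack : ℕ → Bool
        bOrAOrBack v = (v ≡ᵇ b) ∨ aOrBack v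

        aOrBack-b : aOrBack b ≡ false
        aOrBack-b rewrite ≢⇒≡ᵇ-false {b} {a} (λ e → a≢b (sym e)) | inArc-source b a = refl

        -- The old vertices on this arc are b, a and R; old cells cannot serve a or b together
        -- with R, so both take a spare use of E.
        ear-to-ear-around : ∀ i j → fresh i ≡ true → fresh j ≡ true → i ≤ j →
          count⁺ (arc⁺ j i) ≡ (if 2 ≤ᵇ length (freshOut (inArc j i)) then 1 else 0)
        ear-to-ear-around i j ei ej ij =
          trans (assignments-↭ (Perm.trans (vertsWhere-∨-↭ {Q1 = λ v → fresh v ∧ inArc j i v} {Q2 = λ v → P v ∧ bOrAOrBack v}
                   (λ v l → split-mixed (P v) (fresh v) (inArc j i v) (bOrAOrBack v) fresh-new (λ p → trans (inArc-around a b ai jb ij (old-outside p)) (sym (inArc-outside a b a<b (old-outside p)))))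
                   (λ v l → disjoint-mixed (P v) (fresh v) (inArc j i v) (bOrAOrBack v) fresh-new))
                   (++⁺ˡ (freshIn (inArc j i)) (Perm.trans (arc-split b bOrAOrBack aOrBack b∈P b<n (λ v p → refl) aOrBack-b)
                                                   (Perm.prep b (arc-split a aOrBack (inArc b a) a∈P an (λ v p → refl) (inArc-target b a)))))) st⁺)
            (trans (assignments-freshIn (inArc j i) (b ∷ a ∷ R))
              (assignments-∷ʳ-pair E st a b R _ a∈E b∈E R∉E count-ba count-aR count-bR))
          where
          ai : a < i
          ai = proj₁ (fresh-between ei)
          jb : j < b
          jb = proj₁ (proj₂ (fresh-between ej))

        ear-to-ear : ∀ i j → fresh i ≡ true → fresh j ≡ true → i < j → i < n → j < n → (count⁺ (arc⁺ i j) ≡ 1) × (count⁺ (arc⁺ j i) ≡ 1)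
        ear-to-ear i j ei ej ij il jl =
          trans (cong count⁺ (trans (vertsWhere-cong (λ v l → split-private (P v) (fresh v) (inArc i j v) (λ p → ≢true⇒≡false (λ e → true≢false (trans (sym p) (fresh-new e))))
                                   (λ p → inArc-within a b (<⇒≤ ai) (<⇒≤ jb) ij (old-outside p)))) (sym (++-identityʳ _))))
                (assignments-freshIn (inArc i j) [])
          , trans (ear-to-ear-around i j ei ej (<⇒≤ ij)) (two (∈⇒length≥2 (freshOut-∈ (inArc j i) i il ei (inArc-target j i)) (freshOut-∈ (inArc j i) j jl ej (inArc-source j i)) (<⇒≢ ij)))
          where
          ai : a < i
          ai = proj₁ (fresh-between ei)
          jb : j < b
          jb = proj₁ (proj₂ (fresh-between ej))
          two : ∀ {m} → 2 ≤ m → (if 2 ≤ᵇ m then 1 else 0) ≡ 1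
          two {suc (suc m)} _ = refl
          two {suc zero} (s≤s ())

        ear-loop : ∀ i → fresh i ≡ true → i < n → count⁺ (arc⁺ i i) ≡ 0
        ear-loop i ei il = trans (ear-to-ear-around i i ei ei ≤-refl) (cong (λ z → if 2 ≤ᵇ length z then 1 else 0) ci)
          where
          ci : freshOut (inArc i i) ≡ i ∷ []
          ci = trans (sym (vertsWhere-∧ (λ v → not (inArc i i v)) fresh)) (trans (vertsWhere-cong pt) (vertsWhere-single i il))
            where
            pt : ∀ v → v < n → (fresh v ∧ not (inArc i i v)) ≡ (v ≡ᵇ i)
            pt v l with ≡⊎≢ v i
            ... | inj₁ refl rewrite ei | inArc-source v v | ≡ᵇ-refl v = refl
            ... | inj₂ ne rewrite inArc-loop ne | ≢⇒≡ᵇ-false ne = ∧-zeroʳ _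

        ear-old-symmetric : ∀ i j → fresh i ≡ true → i < n → j < n → P j ≡ true → count⁺ (arc⁺ i j) ≡ count⁺ (arc⁺ j i)
        ear-old-symmetric i j ei il jl pj =
          trans (ear-to-old i j ei il pj)
            (trans (cong₂ _+_ (proj₁ sym′ b j b<n jl b∈P pj) (proj₁ sym′ a j an jl a∈P pj))
              (trans (+-comm (count (arc′ j b)) (count (arc′ j a))) (sym (old-to-ear i j ei il pj))))

        step-symmetric : Symmetric P⁺ st⁺
        step-symmetric = sy , ze
          where
          sy : ∀ i j → i < n → j < n → P⁺ i ≡ true → P⁺ j ≡ true → count⁺ (arc⁺ i j) ≡ count⁺ (arc⁺ j i)
          sy i j il jl p1i p1j with ∨-true⇒ {P i} p1i | ∨-true⇒ {P j} p1j
          ... | inj₁ pi | inj₁ pj with ≡⊎≢ i j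
          ...   | inj₁ refl = refl
          ...   | inj₂ ne with covers⊎misses a b i j a<b (old-outside pi) (old-outside pj) ne
          ...     | inj₁ (cv , em) = trans (covered-arc i j cv) (trans (proj₁ sym′ i j il jl pi pj) (sym (missed-arc j i em)))
          ...     | inj₂ (cv , em) = trans (missed-arc i j em) (trans (proj₁ sym′ i j il jl pi pj) (sym (covered-arc j i cv)))
          sy i j il jl p1i p1j | inj₂ ei | inj₁ pj = ear-old-symmetric i j ei il jl pj
          sy i j il jl p1i p1j | inj₁ pi | inj₂ ej = sym (ear-old-symmetric j i ej jl il pi)
          sy i j il jl p1i p1j | inj₂ ei | inj₂ ej with <-cmp i j
          ... | tri< l _ _ = let c = ear-to-ear i j ei ej l il jl in trans (proj₁ c) (sym (proj₂ c))
          ... | tri≈ _ refl _ = refl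
          ... | tri> _ _ g = let c = ear-to-ear j i ej ei g jl il in trans (proj₂ c) (sym (proj₁ c))
          ze : ∀ i → i < n → P⁺ i ≡ true → count⁺ (arc⁺ i i) ≡ 0
          ze i il p1i with ∨-true⇒ {P i} p1i
          ... | inj₁ pi = trans (covered-arc i i (covers-loop a b i (old-outside pi))) (proj₂ sym′ i il pi)
          ... | inj₂ ei = ear-loop i ei il

    step-within : Within P⁺ st⁺
    step-within = AllP.++⁺ (All.map (λ {cr} h w i → cong (_∨ fresh w) (h w i)) within) (ce ∷ [])
      where
      ce : ∀ w → w ∈ᵇ E ≡ true → P⁺ w ≡ true
      ce w i with E-verts w i
      ... | inj₁ refl rewrite a∈P = refl
      ... | inj₂ (inj₁ refl) rewrite b∈P = refl
      ... | inj₂ (inj₂ (l , u)) rewrite fresh-intro l u i = ∨-zeroʳ _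

    step-bounded : ∀ v → P⁺ v ≡ true → v < n
    step-bounded v p with ∨-true⇒ {P v} p
    ... | inj₁ q = P-bounded v q
    ... | inj₂ e = <-trans (proj₁ (proj₂ (fresh-between e))) b<n

module Traversal (n d : ℕ) (3≤d : 3 ≤ d) where
  open Vertices n
  open EarStep n d

  Good : (ℕ → Bool) → Pool → Set
  Good P st = Symmetric P st × Within P st × (∀ v → P v ≡ true → v < n)

  Good-cong : ∀ {P Q} st → (∀ v → P v ≡ Q v) → Good P st → Good Q st
  Good-cong {P} {Q} st h (iv , cv , bd) =
    Symmetric-cong st (λ v _ → h v) iv
    , All.map (λ {cr} k w i → trans (sym (h w)) (k w i)) cv
    , (λ v q → bd v (trans (h v) q))

  1≤d∸1 : 1 ≤ d ∸ 1
  1≤d∸1 = ≤-trans (s≤s z≤n) (∸-monoˡ-≤ 1 3≤d)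

  mutual
    dang-< : ∀ {x y} → Dang d x y → x < y
    dang-< (side a) = ≤-refl
    dang-< (poly ch) = chain-< ch 1≤d∸1

    chain-< : ∀ {k x y} → Chain d k x y → 1 ≤ k → x < y
    chain-< (D ∷ []) _ = dang-< D
    chain-< (D ∷ (D' ∷ ch)) _ = <-trans (dang-< D) (chain-< (D' ∷ ch) (s≤s z≤n))

  chain-≤ : ∀ {k x y} → Chain d k x y → x ≤ y
  chain-≤ [] = ≤-refl
  chain-≤ (D ∷ ch) = <⇒≤ (chain-< (D ∷ ch) (s≤s z≤n))

  verts-sorted : ∀ {k x y} (ch : Chain d k x y) → SortedFrom (suc x) (verts ch)
  verts-sorted [] = tt
  verts-sorted (D ∷ ch) = dang-< D , verts-sorted ch

  verts-≤ : ∀ {k x y} (ch : Chain d k x y) → All (λ v → v ≤ y) (verts ch)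
  verts-≤ [] = []
  verts-≤ (D ∷ ch) = chain-≤ ch ∷ verts-≤ ch

  verts-last : ∀ {k x y} (ch : Chain d k x y) → 1 ≤ k → y ∈ᵇ verts ch ≡ true
  verts-last {y = y} (D ∷ []) _ rewrite ≡ᵇ-refl y = refl
  verts-last {y = y} (_∷_ {b = z} D (D' ∷ ch)) _ rewrite verts-last (D' ∷ ch) (s≤s z≤n) = ∨-zeroʳ _

  verts-interior : ∀ {k x y} (ch : Chain d k x y) x' → x' ≤ x → 1 ≤ k → length (select (λ v → (x' <ᵇ v) ∧ (v <ᵇ y)) (verts ch)) ≡ k ∸ 1
  verts-interior {y = y} (D ∷ []) x' l _ rewrite <ᵇ-irrefl {y} | ∧-zeroʳ (x' <ᵇ y) = refl
  verts-interior {y = y} (_∷_ {b = z} D (D' ∷ ch)) x' l _ =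
    trans (cong length (select-keep (λ v → (x' <ᵇ v) ∧ (v <ᵇ y)) z (verts (D' ∷ ch)) (cong₂ _∧_ (<⇒<ᵇ-true (≤-<-trans l (dang-< D))) (<⇒<ᵇ-true (chain-< (D' ∷ ch) (s≤s z≤n))))))
      (cong suc (verts-interior (D' ∷ ch) x' (≤-trans l (<⇒≤ (dang-< D))) (s≤s z≤n)))
    where
    select-keep : ∀ Q x xs → Q x ≡ true → select Q (x ∷ xs) ≡ x ∷ select Q xs
    select-keep Q x xs e rewrite e = refl

  verts-range : ∀ {k x y} (ch : Chain d k x y) v → v ∈ᵇ verts ch ≡ true → (x < v) × (v ≤ y)
  verts-range {x = x} {y} ch v i = go (verts ch) (verts-sorted ch) (verts-≤ ch) i
    where
    go : ∀ {lo} vs → SortedFrom lo vs → All (λ w → w ≤ y) vs → v ∈ᵇ vs ≡ true → (lo ≤ v) × (v ≤ y)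
    go (w ∷ vs) (l , h) (b ∷ bs) e with ≡⊎≢ w v
    ... | inj₁ refl = l , b
    ... | inj₂ ne rewrite ≢⇒≡ᵇ-false ne = let r = go vs h bs e in ≤-trans l (≤-trans (n≤1+n w) (proj₁ r)) , proj₂ r

  inside : ℕ → ℕ → ℕ → Bool
  inside x y v = (x <ᵇ v) ∧ (v <ᵇ y)

  inside-empty : ∀ x y v → y ≤ suc x → inside x y v ≡ false
  inside-empty x y v yl with <⊎≥ x v
  ... | inj₁ l rewrite ≥⇒<ᵇ-false (≤-trans yl l) = ∧-zeroʳ _
  ... | inj₂ g rewrite ≥⇒<ᵇ-false g = refl

  inside-join : ∀ x z y v → x < z → z ≤ y → v ≢ z → (inside x z v ∨ inside z y v) ≡ inside x y v
  inside-join x z y v xz zy ne with <⊎≥ v z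
  ... | inj₁ l rewrite ≥⇒<ᵇ-false (<⇒≤ l) | <⇒<ᵇ-true l | <⇒<ᵇ-true (<-≤-trans l zy) = ∨-identityʳ _
  ... | inj₂ g rewrite ≥⇒<ᵇ-false g | <⇒<ᵇ-true (≤∧≢⇒< g (λ e → ne (sym e))) | <⇒<ᵇ-true (<-trans xz (≤∧≢⇒< g (λ e → ne (sym e)))) = refl

  ∨-absorbs : ∀ p e i → (e ≡ true → i ≡ true) → ((p ∨ e) ∨ i) ≡ (p ∨ i)
  ∨-absorbs p true i h rewrite h refl = trans (∨-zeroʳ _) (sym (∨-zeroʳ _))
  ∨-absorbs p false i h rewrite ∨-identityʳ p = refl

  good-unchanged : ∀ {P} st x y → (∀ v → inside x y v ≡ false) → Good P st → Good (λ v → P v ∨ inside x y v) (st ++ [])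
  good-unchanged {P} st x y h g = Good-cong (st ++ []) (λ v → trans (sym (∨-identityʳ (P v))) (cong (P v ∨_) (sym (h v))))
                           (subst (Good P) (sym (++-identityʳ st)) g)

  mutual
    good-dang : ∀ {x y} (D : Dang d x y) P st → Good P st → y < n → P x ≡ true → P y ≡ true →
      (∀ v → x < v → v < y → P v ≡ false) → Good (λ v → P v ∨ inside x y v) (st ++ withCapacity (d ∸ 2) (cellsD D))
    good-dang (side a) P st g yn px py gap = good-unchanged st a (suc a) (λ v → inside-empty a (suc a) v ≤-refl) g
    good-dang {x} {y} (poly ch) P st g yn px py gap =
      Good-cong (st ++ withCapacity (d ∸ 2) (cellsD (poly ch))) (λ v → ∨-absorbs (P v) (fresh v) (inside x y v) (λ e → proj₂ (∧-true⇒ {(v ∈ᵇ E)} e)))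
        (subst (Good (λ v → P⁺ v ∨ inside x y v)) (++-assoc st ((E , d ∸ 2) ∷ []) (withCapacity (d ∸ 2) (cellsC ch)))
          (good-chain ch P⁺ st⁺ good⁺ yn x∈P⁺ P⁺-on-chain))
      where
      E : List ℕ
      E = x ∷ verts ch
      x∈E : x ∈ᵇ E ≡ true
      x∈E rewrite ≡ᵇ-refl x = refl
      y∈E : y ∈ᵇ E ≡ true
      y∈E rewrite verts-last ch 1≤d∸1 = ∨-zeroʳ _
      E-verts : ∀ v → v ∈ᵇ E ≡ true → (v ≡ x) ⊎ (v ≡ y) ⊎ ((x < v) × (v < y))
      E-verts v i with ≡⊎≢ x v
      ... | inj₁ refl = inj₁ refl
      ... | inj₂ ne rewrite ≢⇒≡ᵇ-false ne with verts-range ch v i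
      ... | (l , u) with ≡⊎≢ v y
      ... | inj₁ e = inj₂ (inj₁ e)
      ... | inj₂ ne' = inj₂ (inj₂ (l , ≤∧≢⇒< u ne'))
      open EarStep.Ear n d P st x y E (dang-< (poly ch)) yn px py gap (proj₂ (proj₂ g)) x∈E y∈E E-verts (proj₁ (proj₂ g))
      x<n : x < n
      x<n = <-trans (dang-< (poly ch)) yn
      freshCount : length freshVerts ≡ d ∸ 2
      freshCount = trans (cong length (trans (vertsWhere-∧ (inside x y) (λ v → v ∈ᵇ E))
                   (cong (select (inside x y)) (vertsWhere-sorted E (z≤n , verts-sorted ch) (x<n ∷ All.map (λ u → ≤-<-trans u yn) (verts-≤ ch))))))
               (trans (cong length (select-skip-x (verts ch))) (trans (verts-interior ch x ≤-refl 1≤d∸1) (∸-+-assoc d 1 1)))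
        where
        select-skip-x : ∀ vs → select (inside x y) (x ∷ vs) ≡ select (inside x y) vs
        select-skip-x vs rewrite <ᵇ-irrefl {x} = refl
      good⁺ : Good P⁺ st⁺
      good⁺ = step-symmetric freshCount (proj₁ g) , step-within , step-bounded
      x∈P⁺ : P⁺ x ≡ true
      x∈P⁺ rewrite px = refl
      P⁺-on-chain : ∀ v → x < v → v ≤ y → P⁺ v ≡ (v ∈ᵇ verts ch)
      P⁺-on-chain v xv vy with ≡⊎≢ v y
      ... | inj₁ refl rewrite py = sym (verts-last ch 1≤d∸1)
      ... | inj₂ ne rewrite gap v xv (≤∧≢⇒< vy ne) | <⇒<ᵇ-true xv | <⇒<ᵇ-true (≤∧≢⇒< vy ne) | ≢⇒≡ᵇ-false {x} {v} (λ e → <⇒≢ xv e) = ∧-identityʳ _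

    good-chain : ∀ {k x y} (ch : Chain d k x y) P st → Good P st → y < n → P x ≡ true →
      (∀ v → x < v → v ≤ y → P v ≡ (v ∈ᵇ verts ch)) → Good (λ v → P v ∨ inside x y v) (st ++ withCapacity (d ∸ 2) (cellsC ch))
    good-chain {x = x} [] P st g yn px on-chain = good-unchanged st x x (λ v → inside-empty x x v (n≤1+n x)) g
    good-chain {x = x} {y} (_∷_ {b = z} D ch) P st g yn px on-chain =
      Good-cong (st ++ withCapacity (d ∸ 2) (cellsC (D ∷ ch))) inside-merge
        (subst (Good (λ v → (P v ∨ inside x z v) ∨ inside z y v))
               (trans (++-assoc st (withCapacity (d ∸ 2) (cellsD D)) (withCapacity (d ∸ 2) (cellsC ch))) (cong (st ++_) (sym (map-++ _ (cellsD D) (cellsC ch)))))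
               good-rest)
      where
      zy : z ≤ y
      zy = chain-≤ ch
      zn : z < n
      zn = ≤-<-trans zy yn
      xz : x < z
      xz = dang-< D
      z∈P : P z ≡ true
      z∈P rewrite on-chain z xz zy | ≡ᵇ-refl z = refl
      gap-z : ∀ v → x < v → v < z → P v ≡ false
      gap-z v xv vz rewrite on-chain v xv (≤-trans (<⇒≤ vz) zy) | ≢⇒≡ᵇ-false {z} {v} (λ e → <⇒≢ vz (sym e)) = SortedFrom-∉ (suc z) (verts ch) v (≤-trans vz (n≤1+n z)) (verts-sorted ch)
      good-first : Good (λ v → P v ∨ inside x z v) (st ++ withCapacity (d ∸ 2) (cellsD D))
      good-first = good-dang D P st g zn px z∈P gap-z
      P-on-rest : ∀ v → z < v → v ≤ y → (P v ∨ inside x z v) ≡ (v ∈ᵇ verts ch)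
      P-on-rest v zv vy rewrite on-chain v (<-trans xz zv) vy | ≢⇒≡ᵇ-false {z} {v} (<⇒≢ zv) | ≥⇒<ᵇ-false {v} {z} (<⇒≤ zv) | ∧-zeroʳ (x <ᵇ v) = ∨-identityʳ _
      z∈P₁ : (P z ∨ inside x z z) ≡ true
      z∈P₁ rewrite z∈P = refl
      good-rest : Good (λ v → (P v ∨ inside x z v) ∨ inside z y v)
                       ((st ++ withCapacity (d ∸ 2) (cellsD D)) ++ withCapacity (d ∸ 2) (cellsC ch))
      good-rest = good-chain ch (λ v → P v ∨ inside x z v) (st ++ withCapacity (d ∸ 2) (cellsD D)) good-first yn z∈P₁ P-on-rest
      inside-merge : ∀ v → ((P v ∨ inside x z v) ∨ inside z y v) ≡ (P v ∨ inside x y v)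
      inside-merge v with ≡⊎≢ v z
      ... | inj₁ refl rewrite z∈P = refl
      ... | inj₂ ne = trans (∨-assoc (P v) _ _) (cong (P v ∨_) (inside-join x z y v xz zy ne))

assignments-[]-∈ : ∀ {x} xs → x ∈ xs → assignments [] xs ≡ 0
assignments-[]-∈ (y ∷ xs) _ = refl

module WholePolygon (n d : ℕ) (3≤d : 3 ≤ d) (T : Dang d 0 (n ∸ 1)) where
  open Vertices n
  open EarStep n d
  open Traversal n d 3≤d
  open Walks n

  last : ℕ
  last = n ∸ 1

  0<last : 0 < last
  0<last = dang-< T

  last<n : last < n
  last<n = pred<n n 0<last
    where pred<n : ∀ n → 0 < n ∸ 1 → n ∸ 1 < n
          pred<n (suc n) _ = ≤-refl

  endpoint : ℕ → Bool
  endpoint v = (v ≡ᵇ 0) ∨ (v ≡ᵇ last)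

  endpoint-cases : ∀ v → endpoint v ≡ true → (v ≡ 0) ⊎ (v ≡ last)
  endpoint-cases v p with ∨-true⇒ {v ≡ᵇ 0} p
  ... | inj₁ e = inj₁ (≡ᵇ-true⇒≡ e)
  ... | inj₂ e = inj₂ (≡ᵇ-true⇒≡ e)

  endpoint-last : endpoint last ≡ true
  endpoint-last rewrite ≡ᵇ-refl last = ∨-zeroʳ _

  endpoint-gap : ∀ v → 0 < v → v < last → endpoint v ≡ false
  endpoint-gap v 0<v v<last rewrite ≢⇒≡ᵇ-false (>⇒≢ 0<v) | ≢⇒≡ᵇ-false (<⇒≢ v<last) = refl

  endpoint-arc-empty : ∀ i j → endpoint i ≡ true → endpoint j ≡ true → i ≢ j → arc endpoint i j ≡ []
  endpoint-arc-empty i j pi pj i≢j = vertsWhere-empty outside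
    where
    outside : ∀ v → v < n → (endpoint v ∧ inArc i j v) ≡ false
    outside v _ with endpoint v in pv
    ... | false = refl
    ... | true with endpoint-cases i pi | endpoint-cases j pj | endpoint-cases v pv
    ... | inj₁ refl | inj₁ refl | _         = ⊥-elim (i≢j refl)
    ... | inj₂ refl | inj₂ refl | _         = ⊥-elim (i≢j refl)
    ... | inj₁ refl | inj₂ refl | inj₁ refl = inArc-source 0 last
    ... | inj₁ refl | inj₂ refl | inj₂ refl = inArc-target 0 last
    ... | inj₂ refl | inj₁ refl | inj₁ refl = inArc-target last 0
    ... | inj₂ refl | inj₁ refl | inj₂ refl = inArc-source last 0

  good-side : Good endpoint []
  good-side = (symmetric , loop) , [] , bounded
    where
    symmetric : ∀ i j → i < n → j < n → endpoint i ≡ true → endpoint j ≡ true →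
      assignments [] (arc endpoint i j) ≡ assignments [] (arc endpoint j i)
    symmetric i j _ _ pi pj with ≡⊎≢ i j
    ... | inj₁ refl = refl
    ... | inj₂ i≢j rewrite endpoint-arc-empty i j pi pj i≢j | endpoint-arc-empty j i pj pi (≢-sym i≢j) = refl
    loop : ∀ i → i < n → endpoint i ≡ true → assignments [] (arc endpoint i i) ≡ 0
    loop i _ pi with endpoint-cases i pi
    ... | inj₁ refl = assignments-[]-∈ _ (vertsWhere-complete _ last last<n
                        (trans (cong (_∧ inArc 0 0 last) endpoint-last) (inArc-loop (>⇒≢ 0<last))))
    ... | inj₂ refl = assignments-[]-∈ _ (vertsWhere-complete _ 0 (≤-<-trans z≤n last<n) (inArc-loop (<⇒≢ 0<last)))
    bounded : ∀ v → endpoint v ≡ true → v < n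
    bounded v p with endpoint-cases v p
    ... | inj₁ refl = ≤-<-trans z≤n last<n
    ... | inj₂ refl = last<n

  polygon : ℕ → Bool
  polygon v = endpoint v ∨ inside 0 last v

  polygon-all : ∀ v → v < n → polygon v ≡ true
  polygon-all v v<n with ≡⊎≢ v 0
  ... | inj₁ refl = refl
  ... | inj₂ v≢0 with ≡⊎≢ v last
  ...   | inj₁ refl rewrite endpoint-last = refl
  ...   | inj₂ v≢last with <⊎≥ v last
  ...     | inj₁ l rewrite ≢⇒≡ᵇ-false v≢0 | ≢⇒≡ᵇ-false v≢last | <⇒<ᵇ-true (≤∧≢⇒< z≤n (≢-sym v≢0)) | <⇒<ᵇ-true l = refl
  ...     | inj₂ g = ⊥-elim (<⇒≱ v<n (subst (_≤ v) (m+[n∸m]≡n {1} {n} (≤-trans (s≤s z≤n) last<n)) (≤∧≢⇒< g (≢-sym v≢last))))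

  good-polygon : Good polygon (withCapacity (d ∸ 2) (cellsD T))
  good-polygon = good-dang T endpoint [] good-side last<n refl endpoint-last endpoint-gap

  between-symmetric : ∀ {i j} → i < n → j < n →
    assignments (withCapacity (d ∸ 2) (cellsD T)) (between n i j) ≡ assignments (withCapacity (d ∸ 2) (cellsD T)) (between n j i)
  between-symmetric {i} {j} i<n j<n =
    trans (between-arc i<n j<n)
      (trans (proj₁ (proj₁ good-polygon) i j i<n j<n (polygon-all i i<n) (polygon-all j j<n)) (sym (between-arc j<n i<n)))
    where
    between-arc : ∀ {i j} → i < n → j < n → assignments _ (between n i j) ≡ assignments _ (arc polygon i j)
    between-arc {i} {j} i<n j<n = trans (assignments-↭ (between↭arc i j i<n j<n) _)
      (cong (assignments _) (vertsWhere-cong (λ v v<n → sym (cong (_∧ inArc i j v) (polygon-all v v<n)))))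

theorem2p4 : (d m : ℕ) → 3 ≤ d → (T : DAngulation d (d + m * (d ∸ 2)))
    → (i j : Fin (d + m * (d ∸ 2)))
    → pathMatrix (d + m * (d ∸ 2)) T i j ≡ pathMatrix (d + m * (d ∸ 2)) T j i
theorem2p4 d m 3≤d T i j =
  begin
    countPaths d (cellsD T) (between n (toℕ i) (toℕ j))
  ≡⟨ Bridge.countPaths≡assignments d (cellsD T) (between n (toℕ i) (toℕ j)) ⟩
    assignments (withCapacity (d ∸ 2) (cellsD T)) (between n (toℕ i) (toℕ j))
  ≡⟨ WholePolygon.between-symmetric n d 3≤d T (toℕ<n i) (toℕ<n j) ⟩
    assignments (withCapacity (d ∸ 2) (cellsD T)) (between n (toℕ j) (toℕ i))
  ≡⟨ Bridge.countPaths≡assignments d (cellsD T) (between n (toℕ j) (toℕ i)) ⟨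
    countPaths d (cellsD T) (between n (toℕ j) (toℕ i))
  ∎
  where n = d + m * (d ∸ 2)
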